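{- Let $A\geq a\geq 1$ and $r\geq 2$ be integers. For $n\geq0$ let $\sigma\widetilde{mes}_{r,A,a}(n)=\sum_{\pi\in\overline{\mathcal{P}}(n)}\widetilde{mes}_{r,A,a}(\pi)$. Then \[ \sum_{n=0}^\infty\sigma\widetilde{mes}_{r,A,a}(n)q^{n} =\frac{(-q;q)_{\infty }}{(q;q)_{\infty }}\bigg[a+A\sum_{k=1}^{\infty }\frac{q^{A\binom{k}{2}+ka}}{(-q^{a};q^{A})_{k}}(-q^{(r-2)a};q^{(r-2)A})_{k}\bigg]. \]
   Context: An overpartition is a partition (finite non-increasing sequence of positive integers) in which the first occurrence of each part value may be overlined; $\overline{\mathcal{P}}(n)$ is the set of overpartitions of $n$. $(a;q)_\infty=\prod_{i\geq0}(1-aq^i)$, $(a;q)_n=\prod_{i=0}^{n-1}(1-aq^i)$ (so when $r=2$, $(-q^{0};q^{0})_k=2^k$); $|q|<1$. For $r\geq2$, $\widetilde{mes}_{r,A,a}(\pi)$ is the smallest positive integer $m\equiv a\pmod A$ such that $\pi$ has no overlined part $\overline{m}$ and $\pi$ has fewer than $r-1$ non-overlined parts equal to $m$. -}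

module Defs where

open import Data.Nat as ℕ using (ℕ; zero; suc; _+_; _*_; _≤_; _<_; _∸_; _≟_; _<?_)
open import Data.Nat.Combinatorics using (_C_)
open import Data.Integer as ℤ using (ℤ; +_; -_; 0ℤ; 1ℤ)
open import Data.Nat.ListAction using (sum)
open import Data.Bool.ListAction using (any)
open import Data.List as L using (List; []; _∷_; map; foldr; upTo; zipWith; length)
open import Data.Bool using (Bool; true; false; if_then_else_; not; _∧_)
open import Data.Product using (_×_; _,_; proj₁; proj₂; Σ-syntax)
open import Data.Sum using (_⊎_)
open import Relation.Nullary using (does)
open import Relation.Binary.PropositionalEquality using (_≡_)
open import Data.List.Relation.Unary.All using (All)
open import Data.List.Relation.Unary.Linked using (Linked)
open import Data.List.Relation.Unary.Unique.Propositional using (Unique)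
open import Data.List.Membership.Propositional using (_∈_)
open import Function.Bundles using (_⇔_)

-- Formal power series in q with integer coefficients: n ↦ [q^n]

Series : Set
Series = ℕ → ℤ

sumℤ : List ℤ → ℤ
sumℤ = foldr ℤ._+_ 0ℤ

_⊛_ : Series → Series → Series
(f ⊛ g) n = sumℤ (map (λ i → f i ℤ.* g (n ∸ i)) (upTo (suc n)))

_⊕_ : Series → Series → Series
(f ⊕ g) n = f n ℤ.+ g n

infixl 7 _⊛_
infixl 6 _⊕_

const : ℤ → Series
const c zero    = c
const c (suc _) = 0ℤ

one : Series
one = const 1ℤ

monomial : ℤ → ℕ → Series
monomial c e n = if does (n ≟ e) then c else 0ℤ

prodS : List Series → Series
prodS = foldr _⊛_ one

-- (c q^b ; q^s)_k = ∏_{i<k} (1 + c q^{b + i s})   (c = -1 gives (q^b;q^s)_k,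
-- c = 1 gives (-q^b;q^s)_k; for b = s = 0 the factors are the constant 1 + c)
qPoch : ℤ → ℕ → ℕ → ℕ → Series
qPoch c b s k = prodS (map (λ i → one ⊕ monomial c (b + i * s)) (upTo k))

-- (c q^b ; q^s)_∞ for b ≥ 1, s ≥ 1: the coefficient of q^n only depends on
-- the factors with i ≤ n (later factors are 1 + O(q^{n+1})).
qPochInf : ℤ → ℕ → ℕ → Series
qPochInf c b s n = qPoch c b s (suc n) n

-- Formal multiplicative inverse of a series with constant term 1:
-- b₀ = 1, b_{m} = - Σ_{i=1}^{m} f_i b_{m-i}.
-- invRev f n = [b_n , b_{n-1} , … , b_0]
invRev : Series → ℕ → List ℤ
invRev f zero    = 1ℤ ∷ []
invRev f (suc n) =
  (- sumℤ (zipWith ℤ._*_ (map f (map suc (upTo (suc n)))) (invRev f n))) ∷ invRev f n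

headOr0 : List ℤ → ℤ
headOr0 []      = 0ℤ
headOr0 (x ∷ _) = x

inv : Series → Series
inv f n = headOr0 (invRev f n)

-- A part is (m , o) with m its value and o = true iff
-- it is overlined.  An overpartition is listed in non-increasing order;
-- among parts of equal value only the first one may be overlined.

Part : Set
Part = ℕ × Bool

Adj : Part → Part → Set
Adj (m , _) (m' , o') = m' < m ⊎ (m' ≡ m × o' ≡ false)

weight : List Part → ℕ
weight π = sum (map proj₁ π)

IsOverpartition : ℕ → List Part → Set
IsOverpartition n π = All (λ p → 1 ≤ proj₁ p) π × Linked Adj π × weight π ≡ n

Enumerates : ℕ → List (List Part) → Set
Enumerates n Ls = Unique Ls × (∀ π → (π ∈ Ls) ⇔ IsOverpartition n π)

hasOver : ℕ → List Part → Bool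
hasOver m π = any (λ p → does (proj₁ p ≟ m) ∧ proj₂ p) π

countPlain : ℕ → List Part → ℕ
countPlain m π = sum (map (λ p → if does (proj₁ p ≟ m) ∧ not (proj₂ p) then 1 else 0) π)

free : ℕ → List Part → ℕ → Bool
free r π m = not (hasOver m π) ∧ does (countPlain m π <? r ∸ 1)

-- With 1 ≤ a ≤ A the positive integers ≡ a (mod A) are a + jA, j ≥ 0.
-- Search j = j₀, j₀+1, … for the first admissible candidate.  With fuel
-- length π (starting at j₀ = 0) the last candidate a + (length π)A is
-- necessarily admissible (each blocked candidate uses up ≥ 1 part of π),
-- so the fuel bound never affects the value.
mesSearch : ℕ → ℕ → ℕ → List Part → ℕ → ℕ → ℕ
mesSearch r A a π zero    j = a + j * A
mesSearch r A a π (suc f) j =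
  if free r π (a + j * A) then a + j * A else mesSearch r A a π f (suc j)

mes : ℕ → ℕ → ℕ → List Part → ℕ
mes r A a π = mesSearch r A a π (length π) 0

sumMes : ℕ → ℕ → ℕ → List (List Part) → ℕ
sumMes r A a Ls = sum (map (mes r A a) Ls)

term : ℕ → ℕ → ℕ → ℕ → Series
term r A a k =
  monomial 1ℤ (A * (k C 2) + k * a)
  ⊛ inv (qPoch 1ℤ a A k)
  ⊛ qPoch 1ℤ ((r ∸ 2) * a) ((r ∸ 2) * A) k

-- Σ_{k ≥ 1} term k ; term k = O(q^k), so [q^n] only involves k ≤ n
termSum : ℕ → ℕ → ℕ → Series
termSum r A a n = sumℤ (map (λ k → term r A a k n) (map suc (upTo n)))

rhs : ℕ → ℕ → ℕ → Series
rhs r A a =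
  qPochInf 1ℤ 1 1 ⊛ inv (qPochInf (- 1ℤ) 1 1)
  ⊛ (const (+ a) ⊕ const (+ A) ⊛ termSum r A a)

-- Let c_i = a + iA be the candidates. As mes~(π) is the first candidate that is not blocked in π
-- (blocked: m̄ occurs, or at least r − 1 plain parts m do), mes~(π) = a + A · #{k ≥ 1 : c_0, …, c_{k-1}
-- are all blocked in π}. Summing over π gives a · D + A · Σ_k G_k, where D = (-q;q)_∞/(q;q)_∞ counts
-- overpartitions and G_k counts those in which c_0, …, c_{k-1} are blocked. Both factor over the part
-- sizes m: the parts of size m contribute (1 + q^m)/(1 - q^m), and for a blocked m instead
-- (q^m + q^{(r-1)m})/(1 - q^m) = q^m (1 + q^{(r-2)m})/(1 - q^m). Hence
-- G_k = D q^{c_0 + ⋯ + c_{k-1}} (-q^{(r-2)a};q^{(r-2)A})_k / (-q^a;q^A)_k with c_0 + ⋯ + c_{k-1} = A binom(k,2) + ka.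
-- Everything is proved coefficientwise up to q^N, where only parts and multiplicities ≤ N matter and all
-- products are finite.

module Submission where

open import Defs
open import Data.Nat using (ℕ; _≤_)
open import Data.Integer using (+_)
open import Data.List using (List)
open import Data.Product using (_×_; Σ-syntax; _,_)
open import Relation.Binary.PropositionalEquality using (_≡_)
open import Algebra.Bundles using (CommutativeMonoid)
import Data.Integer.Properties
import Data.Nat.Properties

module Sums {c ℓ} (M : CommutativeMonoid c ℓ) where

  open CommutativeMonoid M renaming (Carrier to C)
  open import Data.Nat using (zero; suc; _∸_; _<_; _≤_; z≤n; s≤s)
  import Data.Nat.Properties as ℕP
  open import Data.List using ([]; _∷_; _++_; map; foldr; applyUpTo; concatMap)
  open import Data.List.Relation.Unary.All using (All; []; _∷_)
  open import Data.Sum using (inj₁; inj₂)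
  open import Function using (_∘_)
  import Data.List.Properties as LP
  open import Relation.Binary.PropositionalEquality using () renaming (refl to ≡-refl; cong to ≡-cong; sym to ≡-sym)
  open import Relation.Binary.Reasoning.Setoid setoid
  open import Algebra.Properties.CommutativeSemigroup commutativeSemigroup using (interchange)

  sum : List C → C
  sum = foldr _∙_ ε

  Σ< : ℕ → (ℕ → C) → C
  Σ< k F = sum (applyUpTo F k)

  sum-++ : ∀ xs ys → sum (xs ++ ys) ≈ sum xs ∙ sum ys
  sum-++ []       ys = sym (identityˡ (sum ys))
  sum-++ (x ∷ xs) ys = trans (∙-congˡ (sum-++ xs ys)) (sym (assoc x (sum xs) (sum ys)))

  module _ {A : Set} where

    sum-map-cong : ∀ {f g : A → C} xs → All (λ x → f x ≈ g x) xs → sum (map f xs) ≈ sum (map g xs)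
    sum-map-cong []       []       = refl
    sum-map-cong (x ∷ xs) (p ∷ ps) = ∙-cong p (sum-map-cong xs ps)

    sum-map-∙ : ∀ (f g : A → C) xs → sum (map (λ x → f x ∙ g x) xs) ≈ sum (map f xs) ∙ sum (map g xs)
    sum-map-∙ f g []       = sym (identityˡ ε)
    sum-map-∙ f g (x ∷ xs) = trans (∙-congˡ (sum-map-∙ f g xs)) (interchange (f x) (g x) _ _)

    sum-concatMap : ∀ {B : Set} (f : B → C) (g : A → List B) xs →
      sum (map f (concatMap g xs)) ≈ sum (map (λ x → sum (map f (g x))) xs)
    sum-concatMap f g []       = refl
    sum-concatMap f g (x ∷ xs) = begin
      sum (map f (g x ++ concatMap g xs))                ≡⟨ ≡-cong sum (LP.map-++ f (g x) _) ⟩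
      sum (map f (g x) ++ map f (concatMap g xs))        ≈⟨ sum-++ (map f (g x)) _ ⟩
      sum (map f (g x)) ∙ sum (map f (concatMap g xs))   ≈⟨ ∙-congˡ (sum-concatMap f g xs) ⟩
      sum (map (λ y → sum (map f (g y))) (x ∷ xs))       ∎

  Σ<-cong : ∀ k {F G : ℕ → C} → (∀ i → i < k → F i ≈ G i) → Σ< k F ≈ Σ< k G
  Σ<-cong zero    eq = refl
  Σ<-cong (suc k) eq = ∙-cong (eq 0 (s≤s z≤n)) (Σ<-cong k (λ i i<k → eq (suc i) (s≤s i<k)))

  Σ<-zero : ∀ k (F : ℕ → C) → (∀ i → i < k → F i ≈ ε) → Σ< k F ≈ ε
  Σ<-zero zero    F z = refl
  Σ<-zero (suc k) F z = trans (∙-cong (z 0 (s≤s z≤n)) (Σ<-zero k (F ∘ suc) (λ i i<k → z (suc i) (s≤s i<k))))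
                              (identityˡ ε)

  Σ<-∙ : ∀ k (F G : ℕ → C) → Σ< k (λ i → F i ∙ G i) ≈ Σ< k F ∙ Σ< k G
  Σ<-∙ zero    F G = sym (identityˡ ε)
  Σ<-∙ (suc k) F G = trans (∙-congˡ (Σ<-∙ k (F ∘ suc) (G ∘ suc))) (interchange (F 0) (G 0) _ _)

  Σ<-snoc : ∀ k (F : ℕ → C) → Σ< (suc k) F ≈ Σ< k F ∙ F k
  Σ<-snoc zero    F = trans (identityʳ (F 0)) (sym (identityˡ (F 0)))
  Σ<-snoc (suc k) F = trans (∙-congˡ (Σ<-snoc k (F ∘ suc))) (sym (assoc (F 0) _ _))

  Σ<-reverse : ∀ k (F : ℕ → C) → Σ< k F ≈ Σ< k (λ i → F (k ∸ suc i))
  Σ<-reverse zero    F = refl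
  Σ<-reverse (suc k) F = begin
    F 0 ∙ Σ< k (F ∘ suc)                       ≈⟨ ∙-congˡ (Σ<-reverse k (F ∘ suc)) ⟩
    F 0 ∙ Σ< k (λ i → F (suc (k ∸ suc i)))     ≈⟨ ∙-congˡ (Σ<-cong k (λ i i<k → reflexive (≡-cong F (≡-sym (ℕP.+-∸-assoc 1 i<k))))) ⟩
    F 0 ∙ Σ< k (λ i → F (k ∸ i))               ≈⟨ comm (F 0) _ ⟩
    Σ< k (λ i → F (k ∸ i)) ∙ F 0               ≈⟨ ∙-congˡ (reflexive (≡-cong F (≡-sym (ℕP.n∸n≡0 k)))) ⟩
    Σ< k (λ i → F (k ∸ i)) ∙ F (k ∸ k)         ≈⟨ sym (Σ<-snoc k (λ i → F (k ∸ i))) ⟩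
    Σ< (suc k) (λ i → F (k ∸ i))               ∎

  Σ<-extend : ∀ j k (F : ℕ → C) → j ≤ k → (∀ i → j ≤ i → i < k → F i ≈ ε) → Σ< j F ≈ Σ< k F
  Σ<-extend j zero    F z≤n z = refl
  Σ<-extend j (suc k) F j≤ z with ℕP.m≤n⇒m<n∨m≡n j≤
  ... | inj₂ ≡-refl = refl
  ... | inj₁ (s≤s j≤k) = begin
    Σ< j F        ≈⟨ Σ<-extend j k F j≤k (λ i j≤i i<k → z i j≤i (ℕP.m≤n⇒m≤1+n i<k)) ⟩
    Σ< k F        ≈⟨ sym (identityʳ _) ⟩
    Σ< k F ∙ ε    ≈⟨ ∙-congˡ (sym (z k j≤k ℕP.≤-refl)) ⟩
    Σ< k F ∙ F k  ≈⟨ sym (Σ<-snoc k F) ⟩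
    Σ< (suc k) F  ∎

  sum-map-Σ< : ∀ {A : Set} k (F : A → ℕ → C) xs →
    sum (map (λ x → Σ< k (F x)) xs) ≈ Σ< k (λ i → sum (map (λ x → F x i) xs))
  sum-map-Σ< k F []       = sym (Σ<-zero k (λ _ → ε) (λ _ _ → refl))
  sum-map-Σ< k F (x ∷ xs) = trans (∙-congˡ (sum-map-Σ< k F xs)) (sym (Σ<-∙ k (F x) _))

  Σ<-comm : ∀ j k (F : ℕ → ℕ → C) → Σ< j (λ i → Σ< k (F i)) ≈ Σ< k (λ l → Σ< j (λ i → F i l))
  Σ<-comm zero    k F = sym (Σ<-zero k (λ _ → ε) (λ _ _ → refl))
  Σ<-comm (suc j) k F = trans (∙-congˡ (Σ<-comm j k (F ∘ suc))) (sym (Σ<-∙ k (F 0) _))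

module ℤΣ = Sums Data.Integer.Properties.+-0-commutativeMonoid
module ℕΣ = Sums Data.Nat.Properties.+-0-commutativeMonoid

module IntegerSums where

  open import Data.Nat using (zero; suc)
  open import Data.Integer using (ℤ; _+_; _*_)
  import Data.Integer.Properties as ℤP
  open import Data.List using ([]; _∷_; map; applyUpTo)
  open import Data.List.Properties using (map-applyUpTo)
  open import Relation.Binary.PropositionalEquality using (refl; cong; trans; sym)
  open import Function using (_∘_)
  open ℤΣ

  sum-map-*ˡ : ∀ {A : Set} c (f : A → ℤ) xs → sum (map (λ x → c * f x) xs) ≡ c * sum (map f xs)
  sum-map-*ˡ c f []       = sym (ℤP.*-zeroʳ c)
  sum-map-*ˡ c f (x ∷ xs) = trans (cong (_+_ (c * f x)) (sum-map-*ˡ c f xs)) (sym (ℤP.*-distribˡ-+ c (f x) _))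

  Σ<-*ˡ : ∀ k c (F : ℕ → ℤ) → Σ< k (λ i → c * F i) ≡ c * Σ< k F
  Σ<-*ˡ zero    c F = sym (ℤP.*-zeroʳ c)
  Σ<-*ˡ (suc k) c F = trans (cong (_+_ (c * F 0)) (Σ<-*ˡ k c (F ∘ suc))) (sym (ℤP.*-distribˡ-+ c (F 0) _))

  pos-sum : ∀ xs → + ℕΣ.sum xs ≡ sum (map +_ xs)
  pos-sum []       = refl
  pos-sum (x ∷ xs) = trans (ℤP.pos-+ x (ℕΣ.sum xs)) (cong (_+_ (+ x)) (pos-sum xs))

  pos-Σ< : ∀ k (F : ℕ → ℕ) → + ℕΣ.Σ< k F ≡ Σ< k (λ i → + F i)
  pos-Σ< k F = trans (pos-sum (applyUpTo F k)) (cong sum (map-applyUpTo F +_ k))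

module Candidates (A a : ℕ) (1≤a : 1 ≤ a) (1≤A : 1 ≤ A) where

  open import Data.Nat as ℕ using (zero; suc; _<_; _≡ᵇ_)
  import Data.Nat.Properties as ℕP
  open import Data.Bool using (Bool; false; _∨_)
  open import Relation.Nullary.Decidable using (dec-false)
  open import Relation.Binary.PropositionalEquality using (refl)

  candidate : ℕ → ℕ
  candidate i = a ℕ.+ i ℕ.* A

  candidate-mono : ∀ {i k} → i < k → candidate i < candidate k
  candidate-mono i<k = ℕP.+-monoʳ-< a (ℕP.*-monoˡ-< A {{ℕ.>-nonZero 1≤A}} i<k)

  candidate-positive : ∀ i → 1 ≤ candidate i
  candidate-positive i = ℕP.≤-trans 1≤a (ℕP.m≤m+n a (i ℕ.* A))

  isCandidate : ℕ → ℕ → Bool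
  isCandidate zero    m = false
  isCandidate (suc k) m = isCandidate k m ∨ (m ≡ᵇ candidate k)

  isCandidate-≥ : ∀ k m → candidate k ≤ m → isCandidate k m ≡ false
  isCandidate-≥ zero    m _    = refl
  isCandidate-≥ (suc k) m ck≤m
    rewrite isCandidate-≥ k m (ℕP.≤-trans (ℕP.<⇒≤ (candidate-mono (ℕP.n<1+n k))) ck≤m)
          | dec-false (m ℕ.≟ candidate k) (ℕP.>⇒≢ (ℕP.<-≤-trans (candidate-mono (ℕP.n<1+n k)) ck≤m)) = refl

module Products {c ℓ} (Mon : CommutativeMonoid c ℓ) where

  open CommutativeMonoid Mon renaming (Carrier to C)
  open import Data.Nat as ℕ using (zero; suc; _<_; _≡ᵇ_; z≤n; s≤s)
  import Data.Nat.Properties as ℕP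
  open import Data.Bool using (true; false; if_then_else_)
  open import Data.Bool.Properties using (∨-identityʳ)
  open import Data.Sum using (inj₁; inj₂)
  open import Relation.Nullary using (yes; no)
  open import Relation.Nullary.Decidable using (dec-true; dec-false)
  open import Relation.Binary.PropositionalEquality using () renaming (refl to ≡-refl)
  open import Relation.Binary.Reasoning.Setoid setoid
  open import Algebra.Properties.CommutativeSemigroup commutativeSemigroup using (interchange)

  prodTo : ℕ → (ℕ → C) → C
  prodTo zero    φ = ε
  prodTo (suc M) φ = φ (suc M) ∙ prodTo M φ

  prodTo-cong : ∀ M {φ ψ} → (∀ m → 1 ≤ m → m ≤ M → φ m ≈ ψ m) → prodTo M φ ≈ prodTo M ψ
  prodTo-cong zero    p = refl
  prodTo-cong (suc M) p = ∙-cong (p (suc M) (s≤s z≤n) ℕP.≤-refl) (prodTo-cong M (λ m 1≤m m≤M → p m 1≤m (ℕP.m≤n⇒m≤1+n m≤M)))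

  prodTo-∙ : ∀ M φ ψ → prodTo M (λ m → φ m ∙ ψ m) ≈ prodTo M φ ∙ prodTo M ψ
  prodTo-∙ zero    φ ψ = sym (identityˡ ε)
  prodTo-∙ (suc M) φ ψ = trans (∙-congˡ (prodTo-∙ M φ ψ)) (interchange (φ (suc M)) (ψ (suc M)) _ _)

  onlyAt : ℕ → (ℕ → C) → ℕ → C
  onlyAt v f m = if m ≡ᵇ v then f m else ε

  prodTo-onlyAt-< : ∀ M v f → M < v → prodTo M (onlyAt v f) ≈ ε
  prodTo-onlyAt-< zero    v f _    = refl
  prodTo-onlyAt-< (suc M) v f M<v rewrite dec-false (suc M ℕ.≟ v) (ℕP.<⇒≢ M<v) =
    trans (identityˡ _) (prodTo-onlyAt-< M v f (ℕP.<-trans (ℕP.n<1+n M) M<v))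

  prodTo-onlyAt : ∀ M v f → 1 ≤ v → v ≤ M → prodTo M (onlyAt v f) ≈ f v
  prodTo-onlyAt zero    (suc v) f 1≤v ()
  prodTo-onlyAt (suc M) v f 1≤v v≤1+M with ℕP.m≤n⇒m<n∨m≡n v≤1+M
  ... | inj₂ ≡-refl rewrite dec-true (suc M ℕ.≟ suc M) ≡-refl =
    trans (∙-congˡ (prodTo-onlyAt-< M (suc M) f ℕP.≤-refl)) (identityʳ (f (suc M)))
  ... | inj₁ (s≤s v≤M) rewrite dec-false (suc M ℕ.≟ v) (ℕP.>⇒≢ (s≤s v≤M)) =
    trans (identityˡ _) (prodTo-onlyAt M v f 1≤v v≤M)

  module OnCandidates (A a : ℕ) (1≤a : 1 ≤ a) (1≤A : 1 ≤ A) where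

    open Candidates A a 1≤a 1≤A

    onCandidates : ℕ → (ℕ → C) → ℕ → C
    onCandidates k f m = if isCandidate k m then f m else ε

    prodCandidates : ℕ → (ℕ → C) → C
    prodCandidates zero    f = ε
    prodCandidates (suc k) f = prodCandidates k f ∙ f (candidate k)

    onCandidates-suc : ∀ k f m → onCandidates (suc k) f m ≈ onCandidates k f m ∙ onlyAt (candidate k) f m
    onCandidates-suc k f m with m ℕ.≟ candidate k
    ... | yes ≡-refl rewrite dec-true (m ℕ.≟ m) ≡-refl | isCandidate-≥ k m ℕP.≤-refl = sym (identityˡ (f m))
    ... | no m≢ck rewrite dec-false (m ℕ.≟ candidate k) m≢ck | ∨-identityʳ (isCandidate k m) with isCandidate k m
    ...   | true  = sym (identityʳ (f m))
    ...   | false = sym (identityˡ ε)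

    prodTo-onCandidates : ∀ M k f → (∀ i → i < k → candidate i ≤ M) → prodTo M (onCandidates k f) ≈ prodCandidates k f
    prodTo-onCandidates zero    zero    f _ = refl
    prodTo-onCandidates (suc M) zero    f _ = trans (identityˡ _) (prodTo-onCandidates M zero f (λ _ ()))
    prodTo-onCandidates M       (suc k) f bounded = begin
      prodTo M (onCandidates (suc k) f)                                  ≈⟨ prodTo-cong M (λ m _ _ → onCandidates-suc k f m) ⟩
      prodTo M (λ m → onCandidates k f m ∙ onlyAt (candidate k) f m)     ≈⟨ prodTo-∙ M (onCandidates k f) (onlyAt (candidate k) f) ⟩
      prodTo M (onCandidates k f) ∙ prodTo M (onlyAt (candidate k) f)    ≈⟨ ∙-cong (prodTo-onCandidates M k f (λ i i<k → bounded i (ℕP.m≤n⇒m≤1+n i<k)))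
                                                                                    (prodTo-onlyAt M (candidate k) f (candidate-positive k) (bounded k ℕP.≤-refl)) ⟩
      prodCandidates (suc k) f                                           ∎

module PowerSeries where

  open import Data.Nat as ℕ using (zero; suc; _∸_; _<_; z≤n; s≤s)
  import Data.Nat.Properties as ℕP
  open import Data.Integer using (ℤ; -_; 0ℤ; 1ℤ; _+_; _*_)
  import Data.Integer.Properties as ℤP
  open import Data.Integer.Tactic.RingSolver using (solve-∀)
  open import Data.List using ([]; _∷_; _++_; map; applyUpTo; upTo; zipWith)
  import Data.List.Properties as LP
  open import Data.List.Relation.Unary.All using (All; []; _∷_)
  import Data.List.Relation.Unary.All as All
  import Data.List.Relation.Unary.All.Properties as AllP
  open import Data.Bool using (true; false)
  open import Relation.Nullary using (does)
  open import Relation.Nullary.Decidable using (dec-false)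
  open import Relation.Binary.PropositionalEquality
  open import Function using (_∘_)
  open import Level using (0ℓ)
  open import Relation.Binary.Bundles using (Setoid)
  import Relation.Binary.Reasoning.Setoid
  open ℤΣ using (Σ<; Σ<-cong; Σ<-zero; Σ<-∙; Σ<-reverse; Σ<-comm)
  open IntegerSums using (Σ<-*ˡ)

  infix 4 _≈[_]_

  _≈[_]_ : Series → ℕ → Series → Set
  f ≈[ N ] g = ∀ j → j ≤ N → f j ≡ g j

  ≈-refl : ∀ {f N} → f ≈[ N ] f
  ≈-refl _ _ = refl

  ≈-sym : ∀ {f g N} → f ≈[ N ] g → g ≈[ N ] f
  ≈-sym p j j≤N = sym (p j j≤N)

  ≈-trans : ∀ {f g h N} → f ≈[ N ] g → g ≈[ N ] h → f ≈[ N ] h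
  ≈-trans p q j j≤N = trans (p j j≤N) (q j j≤N)

  ≈[_]-setoid : ℕ → Setoid 0ℓ 0ℓ
  ≈[ N ]-setoid = record
    { Carrier = Series ; _≈_ = _≈[ N ]_
    ; isEquivalence = record { refl = λ {f} → ≈-refl {f} ; sym = ≈-sym ; trans = ≈-trans } }

  module ≈-Reasoning (N : ℕ) = Relation.Binary.Reasoning.Setoid ≈[ N ]-setoid
  module ≗-Reasoning = Relation.Binary.Reasoning.Setoid (ℕ →-setoid ℤ)

  ≗⇒≈ : ∀ {f g N} → f ≗ g → f ≈[ N ] g
  ≗⇒≈ p j _ = p j

  all-≈⇒≗ : ∀ {f g} → (∀ N → f ≈[ N ] g) → f ≗ g
  all-≈⇒≗ p j = p j j ℕP.≤-refl

  0ˢ : Series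
  0ˢ _ = 0ℤ

  tail : Series → Series
  tail f i = f (suc i)

  scale : ℤ → Series → Series
  scale c f i = c * f i

  ⊛-coeff : ∀ f g n → (f ⊛ g) n ≡ Σ< (suc n) (λ i → f i * g (n ∸ i))
  ⊛-coeff f g n = cong sumℤ (LP.map-upTo (λ i → f i * g (n ∸ i)) (suc n))

  ⊛-coeff₀ : ∀ f g → (f ⊛ g) 0 ≡ f 0 * g 0
  ⊛-coeff₀ f g = ℤP.+-identityʳ _

  ⊛-coeff-suc : ∀ f g n → (f ⊛ g) (suc n) ≡ f 0 * g (suc n) + (tail f ⊛ g) n
  ⊛-coeff-suc f g n = trans (⊛-coeff f g (suc n)) (cong (_+_ (f 0 * g (suc n))) (sym (⊛-coeff (tail f) g n)))

  ⊕-cong≈ : ∀ {f f' g g' N} → f ≈[ N ] f' → g ≈[ N ] g' → (f ⊕ g) ≈[ N ] (f' ⊕ g')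
  ⊕-cong≈ p q j j≤N = cong₂ _+_ (p j j≤N) (q j j≤N)

  ⊕-cong : ∀ {f f' g g'} → f ≗ f' → g ≗ g' → (f ⊕ g) ≗ (f' ⊕ g')
  ⊕-cong p q j = cong₂ _+_ (p j) (q j)

  ⊛-cong≈ : ∀ {f f' g g' N} → f ≈[ N ] f' → g ≈[ N ] g' → (f ⊛ g) ≈[ N ] (f' ⊛ g')
  ⊛-cong≈ {f} {f'} {g} {g'} p q j j≤N = begin
    (f ⊛ g) j                                ≡⟨ ⊛-coeff f g j ⟩
    Σ< (suc j) (λ i → f i * g (j ∸ i))       ≡⟨ Σ<-cong (suc j) same-terms ⟩
    Σ< (suc j) (λ i → f' i * g' (j ∸ i))     ≡⟨ ⊛-coeff f' g' j ⟨
    (f' ⊛ g') j                              ∎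
    where
    open ≡-Reasoning
    same-terms : ∀ i → i < suc j → f i * g (j ∸ i) ≡ f' i * g' (j ∸ i)
    same-terms i (s≤s i≤j) = cong₂ _*_ (p i (ℕP.≤-trans i≤j j≤N)) (q (j ∸ i) (ℕP.≤-trans (ℕP.m∸n≤m j i) j≤N))

  ⊛-cong : ∀ {f f' g g'} → f ≗ f' → g ≗ g' → (f ⊛ g) ≗ (f' ⊛ g')
  ⊛-cong p q = all-≈⇒≗ (λ N → ⊛-cong≈ (≗⇒≈ p) (≗⇒≈ q))

  ⊛-congˡ : ∀ {f f'} → f ≗ f' → ∀ g → (f ⊛ g) ≗ (f' ⊛ g)
  ⊛-congˡ p g = ⊛-cong {g = g} p (λ _ → refl)

  ⊛-congʳ : ∀ f {g g'} → g ≗ g' → (f ⊛ g) ≗ (f ⊛ g')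
  ⊛-congʳ f q = ⊛-cong {f = f} (λ _ → refl) q

  ⊛-distribʳ-⊕ : ∀ h f g → ((f ⊕ g) ⊛ h) ≗ ((f ⊛ h) ⊕ (g ⊛ h))
  ⊛-distribʳ-⊕ h f g n = begin
    ((f ⊕ g) ⊛ h) n                                       ≡⟨ ⊛-coeff (f ⊕ g) h n ⟩
    Σ< (suc n) (λ i → (f i + g i) * h (n ∸ i))            ≡⟨ Σ<-cong (suc n) (λ i _ → ℤP.*-distribʳ-+ (h (n ∸ i)) (f i) (g i)) ⟩
    Σ< (suc n) (λ i → f i * h (n ∸ i) + g i * h (n ∸ i))  ≡⟨ Σ<-∙ (suc n) (λ i → f i * h (n ∸ i)) (λ i → g i * h (n ∸ i)) ⟩
    Σ< (suc n) (λ i → f i * h (n ∸ i)) + Σ< (suc n) (λ i → g i * h (n ∸ i)) ≡⟨ cong₂ _+_ (⊛-coeff f h n) (⊛-coeff g h n) ⟨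
    (f ⊛ h) n + (g ⊛ h) n                                 ∎
    where open ≡-Reasoning

  ⊛-scaleˡ : ∀ c f h → (scale c f ⊛ h) ≗ scale c (f ⊛ h)
  ⊛-scaleˡ c f h n = begin
    (scale c f ⊛ h) n                          ≡⟨ ⊛-coeff (scale c f) h n ⟩
    Σ< (suc n) (λ i → c * f i * h (n ∸ i))     ≡⟨ Σ<-cong (suc n) (λ i _ → ℤP.*-assoc c (f i) (h (n ∸ i))) ⟩
    Σ< (suc n) (λ i → c * (f i * h (n ∸ i)))   ≡⟨ Σ<-*ˡ (suc n) c (λ i → f i * h (n ∸ i)) ⟩
    c * Σ< (suc n) (λ i → f i * h (n ∸ i))     ≡⟨ cong (c *_) (⊛-coeff f h n) ⟨
    c * (f ⊛ h) n                              ∎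
    where open ≡-Reasoning

  const-⊛ : ∀ c h → (const c ⊛ h) ≗ scale c h
  const-⊛ c h n = begin
    (const c ⊛ h) n                                    ≡⟨ ⊛-coeff (const c) h n ⟩
    c * h (n ∸ 0) + Σ< n (λ i → 0ℤ * h (n ∸ suc i))   ≡⟨ cong (_+_ (c * h n)) (Σ<-zero n _ (λ i _ → ℤP.*-zeroˡ (h (n ∸ suc i)))) ⟩
    c * h n + 0ℤ                                       ≡⟨ ℤP.+-identityʳ _ ⟩
    c * h n                                            ∎
    where open ≡-Reasoning

  ⊛-comm : ∀ f g → (f ⊛ g) ≗ (g ⊛ f)
  ⊛-comm f g n = begin
    (f ⊛ g) n                                             ≡⟨ ⊛-coeff f g n ⟩
    Σ< (suc n) (λ i → f i * g (n ∸ i))                    ≡⟨ Σ<-reverse (suc n) (λ i → f i * g (n ∸ i)) ⟩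
    Σ< (suc n) (λ i → f (n ∸ i) * g (n ∸ (n ∸ i)))        ≡⟨ Σ<-cong (suc n) swap ⟩
    Σ< (suc n) (λ i → g i * f (n ∸ i))                    ≡⟨ ⊛-coeff g f n ⟨
    (g ⊛ f) n                                             ∎
    where
    open ≡-Reasoning
    swap : ∀ i → i < suc n → f (n ∸ i) * g (n ∸ (n ∸ i)) ≡ g i * f (n ∸ i)
    swap i (s≤s i≤n) = trans (cong (λ x → f (n ∸ i) * g x) (ℕP.m∸[m∸n]≡n i≤n)) (ℤP.*-comm (f (n ∸ i)) (g i))

  ⊛-assoc : ∀ f g h → ((f ⊛ g) ⊛ h) ≗ (f ⊛ (g ⊛ h))
  ⊛-assoc f g h zero = begin
    ((f ⊛ g) ⊛ h) 0      ≡⟨ trans (⊛-coeff₀ (f ⊛ g) h) (cong (_* h 0) (⊛-coeff₀ f g)) ⟩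
    f 0 * g 0 * h 0      ≡⟨ ℤP.*-assoc (f 0) (g 0) (h 0) ⟩
    f 0 * (g 0 * h 0)    ≡⟨ trans (⊛-coeff₀ f (g ⊛ h)) (cong (f 0 *_) (⊛-coeff₀ g h)) ⟨
    (f ⊛ (g ⊛ h)) 0      ∎
    where open ≡-Reasoning
  ⊛-assoc f g h (suc n) = begin
    ((f ⊛ g) ⊛ h) (suc n)
      ≡⟨ ⊛-coeff-suc (f ⊛ g) h n ⟩
    (f ⊛ g) 0 * h (suc n) + (tail (f ⊛ g) ⊛ h) n
      ≡⟨ cong₂ _+_ (cong (_* h (suc n)) (⊛-coeff₀ f g)) (⊛-congˡ (⊛-coeff-suc f g) h n) ⟩
    f 0 * g 0 * h (suc n) + ((scale (f 0) (tail g) ⊕ (tail f ⊛ g)) ⊛ h) n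
      ≡⟨ cong (_+_ (f 0 * g 0 * h (suc n))) (⊛-distribʳ-⊕ h (scale (f 0) (tail g)) (tail f ⊛ g) n) ⟩
    f 0 * g 0 * h (suc n) + ((scale (f 0) (tail g) ⊛ h) n + ((tail f ⊛ g) ⊛ h) n)
      ≡⟨ cong (_+_ (f 0 * g 0 * h (suc n))) (cong₂ _+_ (⊛-scaleˡ (f 0) (tail g) h n) (⊛-assoc (tail f) g h n)) ⟩
    f 0 * g 0 * h (suc n) + (f 0 * (tail g ⊛ h) n + (tail f ⊛ (g ⊛ h)) n)
      ≡⟨ regroup (f 0) (g 0) (h (suc n)) ((tail g ⊛ h) n) ((tail f ⊛ (g ⊛ h)) n) ⟩
    f 0 * (g 0 * h (suc n) + (tail g ⊛ h) n) + (tail f ⊛ (g ⊛ h)) n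
      ≡⟨ cong (λ x → f 0 * x + (tail f ⊛ (g ⊛ h)) n) (⊛-coeff-suc g h n) ⟨
    f 0 * (g ⊛ h) (suc n) + (tail f ⊛ (g ⊛ h)) n
      ≡⟨ ⊛-coeff-suc f (g ⊛ h) n ⟨
    (f ⊛ (g ⊛ h)) (suc n) ∎
    where
    open ≡-Reasoning
    regroup : ∀ a b c d e → a * b * c + (a * d + e) ≡ a * (b * c + d) + e
    regroup = solve-∀

  ⊛-identityˡ : ∀ f → (one ⊛ f) ≗ f
  ⊛-identityˡ f n = trans (const-⊛ 1ℤ f n) (ℤP.*-identityˡ (f n))

  ⊛-identityʳ : ∀ f → (f ⊛ one) ≗ f
  ⊛-identityʳ f n = trans (⊛-comm f one n) (⊛-identityˡ f n)

  ⊛-distribˡ-⊕ : ∀ h f g → (h ⊛ (f ⊕ g)) ≗ ((h ⊛ f) ⊕ (h ⊛ g))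
  ⊛-distribˡ-⊕ h f g n =
    trans (⊛-comm h (f ⊕ g) n) (trans (⊛-distribʳ-⊕ h f g n) (cong₂ _+_ (⊛-comm f h n) (⊛-comm g h n)))

  ⊛-scaleʳ : ∀ c f h → (h ⊛ scale c f) ≗ scale c (h ⊛ f)
  ⊛-scaleʳ c f h n = trans (⊛-comm h (scale c f) n) (trans (⊛-scaleˡ c f h n) (cong (c *_) (⊛-comm f h n)))

  ⊛-Σ<ʳ : ∀ K f (g : ℕ → Series) n → (f ⊛ (λ j → Σ< K (λ k → g k j))) n ≡ Σ< K (λ k → (f ⊛ g k) n)
  ⊛-Σ<ʳ K f g n = begin
    (f ⊛ (λ j → Σ< K (λ k → g k j))) n                      ≡⟨ ⊛-coeff f (λ j → Σ< K (λ k → g k j)) n ⟩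
    Σ< (suc n) (λ i → f i * Σ< K (λ k → g k (n ∸ i)))       ≡⟨ Σ<-cong (suc n) (λ i _ → sym (Σ<-*ˡ K (f i) (λ k → g k (n ∸ i)))) ⟩
    Σ< (suc n) (λ i → Σ< K (λ k → f i * g k (n ∸ i)))       ≡⟨ Σ<-comm (suc n) K (λ i k → f i * g k (n ∸ i)) ⟩
    Σ< K (λ k → Σ< (suc n) (λ i → f i * g k (n ∸ i)))       ≡⟨ Σ<-cong K (λ k _ → sym (⊛-coeff f (g k) n)) ⟩
    Σ< K (λ k → (f ⊛ g k) n)                                ∎
    where open ≡-Reasoning

  ⊛-commutativeMonoid : CommutativeMonoid 0ℓ 0ℓ
  ⊛-commutativeMonoid = record
    { Carrier = Series ; _≈_ = _≗_ ; _∙_ = _⊛_ ; ε = one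
    ; isCommutativeMonoid = record
      { isMonoid = record
        { isSemigroup = record
          { isMagma = record { isEquivalence = Setoid.isEquivalence (ℕ →-setoid ℤ) ; ∙-cong = ⊛-cong }
          ; assoc = ⊛-assoc }
        ; identity = ⊛-identityˡ , ⊛-identityʳ }
      ; comm = ⊛-comm } }

  shift : ℕ → Series → Series
  shift zero    f         = f
  shift (suc e) f zero    = 0ℤ
  shift (suc e) f (suc j) = shift e f j

  shift-< : ∀ e f j → j < e → shift e f j ≡ 0ℤ
  shift-< (suc e) f zero    _         = refl
  shift-< (suc e) f (suc j) (s≤s j<e) = shift-< e f j j<e

  shift-≥ : ∀ e f j → e ≤ j → shift e f j ≡ f (j ∸ e)
  shift-≥ zero    f j       _         = refl
  shift-≥ (suc e) f (suc j) (s≤s e≤j) = shift-≥ e f j e≤j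

  shift-cong≈ : ∀ e {f g N} → f ≈[ N ] g → shift e f ≈[ N ] shift e g
  shift-cong≈ zero    p = p
  shift-cong≈ (suc e) p zero    _ = refl
  shift-cong≈ (suc e) {N = suc N} p (suc j) (s≤s j≤N) =
    shift-cong≈ e {N = N} (λ i i≤N → p i (ℕP.m≤n⇒m≤1+n i≤N)) j j≤N

  shift-⊕ : ∀ e f g → shift e (f ⊕ g) ≗ (shift e f ⊕ shift e g)
  shift-⊕ zero    f g n       = refl
  shift-⊕ (suc e) f g zero    = refl
  shift-⊕ (suc e) f g (suc n) = shift-⊕ e f g n

  shift-0ˢ : ∀ e → shift e 0ˢ ≗ 0ˢ
  shift-0ˢ zero    n       = refl
  shift-0ˢ (suc e) zero    = refl
  shift-0ˢ (suc e) (suc n) = shift-0ˢ e n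

  shift-monomial : ∀ e d c → shift e (monomial c d) ≗ monomial c (e ℕ.+ d)
  shift-monomial zero    d c n       = refl
  shift-monomial (suc e) d c zero    = refl
  shift-monomial (suc e) d c (suc n) = shift-monomial e d c n

  monomial-zero : ∀ c → monomial c 0 ≗ const c
  monomial-zero c zero    = refl
  monomial-zero c (suc n) = refl

  monomial-⊛ : ∀ c e f → (monomial c e ⊛ f) ≗ scale c (shift e f)
  monomial-⊛ c zero f n = trans (⊛-congˡ (monomial-zero c) f n) (const-⊛ c f n)
  monomial-⊛ c (suc e) f zero =
    trans (⊛-coeff₀ (monomial c (suc e)) f) (trans (ℤP.*-zeroˡ (f 0)) (sym (ℤP.*-zeroʳ c)))
  monomial-⊛ c (suc e) f (suc n) = begin
    (monomial c (suc e) ⊛ f) (suc n)                       ≡⟨ ⊛-coeff-suc (monomial c (suc e)) f n ⟩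
    0ℤ * f (suc n) + (tail (monomial c (suc e)) ⊛ f) n     ≡⟨ cong (_+ (monomial c e ⊛ f) n) (ℤP.*-zeroˡ (f (suc n))) ⟩
    0ℤ + (monomial c e ⊛ f) n                              ≡⟨ ℤP.+-identityˡ _ ⟩
    (monomial c e ⊛ f) n                                   ≡⟨ monomial-⊛ c e f n ⟩
    scale c (shift e f) n                                  ∎
    where open ≡-Reasoning

  shift-as-⊛ : ∀ e f → shift e f ≗ (monomial 1ℤ e ⊛ f)
  shift-as-⊛ e f n = sym (trans (monomial-⊛ 1ℤ e f n) (ℤP.*-identityˡ (shift e f n)))

  shift-⊛ : ∀ e f g → (shift e f ⊛ g) ≗ shift e (f ⊛ g)
  shift-⊛ e f g n = begin
    (shift e f ⊛ g) n                ≡⟨ ⊛-congˡ (shift-as-⊛ e f) g n ⟩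
    ((monomial 1ℤ e ⊛ f) ⊛ g) n      ≡⟨ ⊛-assoc (monomial 1ℤ e) f g n ⟩
    (monomial 1ℤ e ⊛ (f ⊛ g)) n      ≡⟨ shift-as-⊛ e (f ⊛ g) n ⟨
    shift e (f ⊛ g) n                ∎
    where open ≡-Reasoning

  scale-monomial : ∀ c d e → scale c (monomial d e) ≗ monomial (c * d) e
  scale-monomial c d e n with does (n ℕ.≟ e)
  ... | true  = refl
  ... | false = ℤP.*-zeroʳ c

  monomial-⊛-monomial : ∀ c d e e' → (monomial c e ⊛ monomial d e') ≗ monomial (c * d) (e ℕ.+ e')
  monomial-⊛-monomial c d e e' n = trans (monomial-⊛ c e (monomial d e') n)
    (trans (cong (c *_) (shift-monomial e e' d n)) (scale-monomial c d (e ℕ.+ e') n))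

  monomial-0ℤ : ∀ e → monomial 0ℤ e ≗ 0ˢ
  monomial-0ℤ e n with does (n ℕ.≟ e)
  ... | true  = refl
  ... | false = refl

  monomial-cancel : ∀ c e → (monomial c e ⊕ monomial (- c) e) ≗ 0ˢ
  monomial-cancel c e n with does (n ℕ.≟ e)
  ... | true  = ℤP.+-inverseʳ c
  ... | false = refl

  monomial-< : ∀ c e j → j < e → monomial c e j ≡ 0ℤ
  monomial-< c e j j<e rewrite dec-false (j ℕ.≟ e) (ℕP.<⇒≢ j<e) = refl

  monomial-≈0ˢ : ∀ c e N → N < e → monomial c e ≈[ N ] 0ˢ
  monomial-≈0ˢ c e N N<e j j≤N = monomial-< c e j (ℕP.≤-<-trans j≤N N<e)

  monomial-⊛-< : ∀ c e f j → j < e → (monomial c e ⊛ f) j ≡ 0ℤ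
  monomial-⊛-< c e f j j<e = trans (monomial-⊛ c e f j) (trans (cong (c *_) (shift-< e f j j<e)) (ℤP.*-zeroʳ c))

  0ˢ-⊛ : ∀ f → (0ˢ ⊛ f) ≗ 0ˢ
  0ˢ-⊛ f n = trans (⊛-congˡ {f = 0ˢ} {f' = const 0ℤ} (λ { zero → refl ; (suc _) → refl }) f n) (trans (const-⊛ 0ℤ f n) (ℤP.*-zeroˡ (f n)))

  private
    zipWith-applyUpTo : ∀ k (F G : ℕ → ℤ) →
      zipWith _*_ (applyUpTo F k) (applyUpTo G k) ≡ applyUpTo (λ i → F i * G i) k
    zipWith-applyUpTo zero    F G = refl
    zipWith-applyUpTo (suc k) F G = cong (F 0 * G 0 ∷_) (zipWith-applyUpTo k (F ∘ suc) (G ∘ suc))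

    invRev-as-applyUpTo : ∀ f n → invRev f n ≡ applyUpTo (λ i → inv f (n ∸ i)) (suc n)
    invRev-as-applyUpTo f zero    = refl
    invRev-as-applyUpTo f (suc n) = cong (inv f (suc n) ∷_) (invRev-as-applyUpTo f n)

  inv-coeff-suc : ∀ f n → inv f (suc n) ≡ - Σ< (suc n) (λ i → f (suc i) * inv f (n ∸ i))
  inv-coeff-suc f n = cong (λ xs → - sumℤ xs) (begin
    zipWith _*_ (map f (map suc (upTo (suc n)))) (invRev f n)
      ≡⟨ cong₂ (zipWith _*_) (trans (cong (map f) (LP.map-upTo suc (suc n))) (LP.map-applyUpTo suc f (suc n)))
                               (invRev-as-applyUpTo f n) ⟩
    zipWith _*_ (applyUpTo (f ∘ suc) (suc n)) (applyUpTo (λ i → inv f (n ∸ i)) (suc n))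
      ≡⟨ zipWith-applyUpTo (suc n) (f ∘ suc) (λ i → inv f (n ∸ i)) ⟩
    applyUpTo (λ i → f (suc i) * inv f (n ∸ i)) (suc n) ∎)
    where open ≡-Reasoning

  ⊛-inverseʳ : ∀ f → f 0 ≡ 1ℤ → (f ⊛ inv f) ≗ one
  ⊛-inverseʳ f f₀ zero    = trans (⊛-coeff₀ f (inv f)) (cong (_* 1ℤ) f₀)
  ⊛-inverseʳ f f₀ (suc n) = begin
    (f ⊛ inv f) (suc n)                  ≡⟨ ⊛-coeff-suc f (inv f) n ⟩
    f 0 * inv f (suc n) + (tail f ⊛ inv f) n ≡⟨ cong₂ _+_ (cong₂ _*_ f₀ (inv-coeff-suc f n)) (⊛-coeff (tail f) (inv f) n) ⟩
    1ℤ * - S + S                         ≡⟨ cong (_+ S) (ℤP.*-identityˡ (- S)) ⟩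
    - S + S                              ≡⟨ ℤP.+-inverseˡ S ⟩
    0ℤ                                   ∎
    where
    open ≡-Reasoning
    S = Σ< (suc n) (λ i → f (suc i) * inv f (n ∸ i))

  quotient≈ : ∀ {X Q P N} → Q 0 ≡ 1ℤ → (X ⊛ Q) ≈[ N ] P → X ≈[ N ] (P ⊛ inv Q)
  quotient≈ {X} {Q} {P} q₀ XQ≈P j j≤N = begin
    X j                        ≡⟨ ⊛-identityʳ X j ⟨
    (X ⊛ one) j                ≡⟨ ⊛-congʳ X (⊛-inverseʳ Q q₀) j ⟨
    (X ⊛ (Q ⊛ inv Q)) j        ≡⟨ ⊛-assoc X Q (inv Q) j ⟨
    ((X ⊛ Q) ⊛ inv Q) j        ≡⟨ ⊛-cong≈ {g = inv Q} XQ≈P ≈-refl j j≤N ⟩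
    (P ⊛ inv Q) j              ∎
    where open ≡-Reasoning

  inv-cong≈ : ∀ {f g N} → f 0 ≡ 1ℤ → g 0 ≡ 1ℤ → f ≈[ N ] g → inv f ≈[ N ] inv g
  inv-cong≈ {f} {g} f₀ g₀ f≈g = ≈-sym (≈-trans (quotient≈ f₀ inv-g-⊛-f) (≗⇒≈ (⊛-identityˡ (inv f))))
    where
    inv-g-⊛-f : (inv g ⊛ f) ≈[ _ ] one
    inv-g-⊛-f = ≈-trans (⊛-cong≈ {f = inv g} ≈-refl f≈g)
                        (≗⇒≈ (λ j → trans (⊛-comm (inv g) g j) (⊛-inverseʳ g g₀ j)))

  open import Algebra.Properties.CommutativeSemigroup (CommutativeMonoid.commutativeSemigroup ⊛-commutativeMonoid)
    public using (xy∙z≈zy∙x; xy∙z≈xz∙y) renaming (interchange to ⊛-interchange)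

  prodS-++ : ∀ fs gs → prodS (fs ++ gs) ≗ (prodS fs ⊛ prodS gs)
  prodS-++ []       gs n = sym (⊛-identityˡ (prodS gs) n)
  prodS-++ (f ∷ fs) gs n = trans (⊛-congʳ f (prodS-++ fs gs) n) (sym (⊛-assoc f (prodS fs) (prodS gs) n))

  prodS-coeff₀ : ∀ fs → All (λ f → f 0 ≡ 1ℤ) fs → prodS fs 0 ≡ 1ℤ
  prodS-coeff₀ []       []       = refl
  prodS-coeff₀ (f ∷ fs) (p ∷ ps) = trans (⊛-coeff₀ f (prodS fs)) (cong₂ _*_ p (prodS-coeff₀ fs ps))

  binomial-coeff₀ : ∀ c e → 1 ≤ e → (one ⊕ monomial c e) 0 ≡ 1ℤ
  binomial-coeff₀ c e 1≤e = cong (_+_ 1ℤ) (monomial-< c e 0 1≤e)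

  ⊛-binomial-< : ∀ X c e j → j < e → (X ⊛ (one ⊕ monomial c e)) j ≡ X j
  ⊛-binomial-< X c e j j<e = begin
    (X ⊛ (one ⊕ monomial c e)) j               ≡⟨ ⊛-distribˡ-⊕ X one (monomial c e) j ⟩
    (X ⊛ one) j + (X ⊛ monomial c e) j         ≡⟨ cong₂ _+_ (⊛-identityʳ X j) (trans (⊛-comm X (monomial c e) j) (monomial-⊛-< c e X j j<e)) ⟩
    X j + 0ℤ                                   ≡⟨ ℤP.+-identityʳ (X j) ⟩
    X j                                        ∎
    where open ≡-Reasoning

  qPoch-suc : ∀ c b s k → qPoch c b s (suc k) ≗ (qPoch c b s k ⊛ (one ⊕ monomial c (b ℕ.+ k ℕ.* s)))
  qPoch-suc c b s k n = begin
    qPoch c b s (suc k) n                           ≡⟨ cong (λ l → prodS (map F l) n) (LP.upTo-∷ʳ k) ⟨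
    prodS (map F (upTo k ++ k ∷ [])) n              ≡⟨ cong (λ l → prodS l n) (LP.map-++ F (upTo k) (k ∷ [])) ⟩
    prodS (map F (upTo k) ++ F k ∷ []) n            ≡⟨ prodS-++ (map F (upTo k)) (F k ∷ []) n ⟩
    (qPoch c b s k ⊛ (F k ⊛ one)) n                 ≡⟨ ⊛-congʳ (qPoch c b s k) (⊛-identityʳ (F k)) n ⟩
    (qPoch c b s k ⊛ F k) n                         ∎
    where
    open ≡-Reasoning
    F = λ i → one ⊕ monomial c (b ℕ.+ i ℕ.* s)

  qPoch-coeff₀ : ∀ c b s k → 1 ≤ b → qPoch c b s k 0 ≡ 1ℤ
  qPoch-coeff₀ c b s k 1≤b = prodS-coeff₀ _ (AllP.map⁺ (All.universal factor₀ (upTo k)))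
    where
    factor₀ : ∀ i → (one ⊕ monomial c (b ℕ.+ i ℕ.* s)) 0 ≡ 1ℤ
    factor₀ i = binomial-coeff₀ c (b ℕ.+ i ℕ.* s) (ℕP.≤-trans 1≤b (ℕP.m≤m+n b _))

  -- The factors (1 + c q^m) with m > j do not change the coefficient of q^j.
  qPoch₁₁-stable : ∀ c j K → j ≤ K → qPoch c 1 1 K j ≡ qPoch c 1 1 j j
  qPoch₁₁-stable c j K j≤K = trans (cong (λ x → qPoch c 1 1 x j) (sym (ℕP.m∸n+n≡m j≤K))) (stable (K ∸ j))
    where
    stable : ∀ d → qPoch c 1 1 (d ℕ.+ j) j ≡ qPoch c 1 1 j j
    stable zero    = refl
    stable (suc d) = trans (qPoch-suc c 1 1 (d ℕ.+ j) j)
      (trans (⊛-binomial-< (qPoch c 1 1 (d ℕ.+ j)) c (1 ℕ.+ (d ℕ.+ j) ℕ.* 1) j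
               (s≤s (ℕP.≤-trans (ℕP.m≤n+m j d) (ℕP.≤-reflexive (sym (ℕP.*-identityʳ (d ℕ.+ j)))))))
             (stable d))

  qPochInf≈qPoch : ∀ c N M → N ≤ M → qPochInf c 1 1 ≈[ N ] qPoch c 1 1 M
  qPochInf≈qPoch c N M N≤M j j≤N =
    trans (qPoch₁₁-stable c j (suc j) (ℕP.n≤1+n j)) (sym (qPoch₁₁-stable c j M (ℕP.≤-trans j≤N N≤M)))

  open Products ⊛-commutativeMonoid public using (prodTo; prodTo-∙)

  prodTo-cong≈ : ∀ M {φ ψ N} → (∀ m → 1 ≤ m → m ≤ M → φ m ≈[ N ] ψ m) → prodTo M φ ≈[ N ] prodTo M ψ
  prodTo-cong≈ zero    p = ≈-refl
  prodTo-cong≈ (suc M) p = ⊛-cong≈ (p (suc M) (s≤s z≤n) ℕP.≤-refl)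
                                   (prodTo-cong≈ M (λ m 1≤m m≤M → p m 1≤m (ℕP.m≤n⇒m≤1+n m≤M)))

  prodTo-coeff₀ : ∀ M φ → (∀ m → 1 ≤ m → φ m 0 ≡ 1ℤ) → prodTo M φ 0 ≡ 1ℤ
  prodTo-coeff₀ zero    φ p = refl
  prodTo-coeff₀ (suc M) φ p = trans (⊛-coeff₀ (φ (suc M)) (prodTo M φ)) (cong₂ _*_ (p (suc M) (s≤s z≤n)) (prodTo-coeff₀ M φ p))

  qPoch₁₁-as-prodTo : ∀ c M → qPoch c 1 1 M ≗ prodTo M (λ m → one ⊕ monomial c m)
  qPoch₁₁-as-prodTo c zero    n = refl
  qPoch₁₁-as-prodTo c (suc M) n = begin
    qPoch c 1 1 (suc M) n                                     ≡⟨ qPoch-suc c 1 1 M n ⟩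
    (qPoch c 1 1 M ⊛ (one ⊕ monomial c (suc (M ℕ.* 1)))) n    ≡⟨ ⊛-cong (qPoch₁₁-as-prodTo c M) (⊕-cong {f = one} (λ _ → refl) last-factor) n ⟩
    (prodTo M P ⊛ P (suc M)) n                                ≡⟨ ⊛-comm (prodTo M P) (P (suc M)) n ⟩
    prodTo (suc M) P n                                        ∎
    where
    open ≡-Reasoning
    P = λ m → one ⊕ monomial c m
    last-factor : monomial c (suc (M ℕ.* 1)) ≗ monomial c (suc M)
    last-factor j = cong (λ e → monomial c (suc e) j) (ℕP.*-identityʳ M)

module Levels where

  open PowerSeries
  open import Data.Nat as ℕ using (zero; suc; _∸_; _<_; _<ᵇ_; _<?_; s≤s)
  import Data.Nat.Properties as ℕP
  open import Data.Integer using (ℤ; -_; 0ℤ; 1ℤ; _+_; _*_)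
  import Data.Integer.Properties as ℤP
  open import Data.Integer.Tactic.RingSolver using (solve-∀)
  open import Data.List using ([]; _∷_; _++_; map; upTo; foldr)
  import Data.List.Properties as LP
  open import Data.Bool using (Bool; true; false; if_then_else_; not; _∧_)
  open import Relation.Nullary using (does; yes; no)
  open import Relation.Nullary.Decidable using (dec-true; dec-false)
  open import Relation.Binary.PropositionalEquality
  open import Function using (_∘_)
  open import Relation.Binary.Definitions using (tri<; tri≈; tri>)

  𝟙 : Bool → ℤ
  𝟙 b = if b then 1ℤ else 0ℤ

  -- The parts of size m of an overpartition: whether m̄ occurs, and how many plain m's.
  State : Set
  State = Bool × ℕ

  stateWeight : ℕ → State → ℕ
  stateWeight m (false , c) = c ℕ.* m
  stateWeight m (true  , c) = suc c ℕ.* m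

  states : ℕ → List State
  states N = map (false ,_) (upTo (suc N)) ++ map (true ,_) (upTo (suc N))

  stateBlocked : ℕ → State → Bool
  stateBlocked t (o , c) = not (not o ∧ (c <ᵇ t))

  ΣSeries : List Series → Series
  ΣSeries = foldr _⊕_ 0ˢ

  levelSeries : ℕ → ℕ → (State → ℤ) → Series
  levelSeries N m α = ΣSeries (map (λ s → monomial (α s) (stateWeight m s)) (states N))

  freeLevel : ℕ → ℕ → Series
  freeLevel N m = levelSeries N m (λ _ → 1ℤ)

  blockedLevel : ℕ → ℕ → ℕ → Series
  blockedLevel N m t = levelSeries N m (𝟙 ∘ stateBlocked t)

  ΣSeries-++ : ∀ fs gs → ΣSeries (fs ++ gs) ≗ (ΣSeries fs ⊕ ΣSeries gs)
  ΣSeries-++ []       gs n = sym (ℤP.+-identityˡ _)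
  ΣSeries-++ (f ∷ fs) gs n = trans (cong (_+_ (f n)) (ΣSeries-++ fs gs n)) (sym (ℤP.+-assoc (f n) _ _))

  ΣSeries-cong : ∀ {A : Set} xs {f g : A → Series} → (∀ x → f x ≗ g x) → ΣSeries (map f xs) ≗ ΣSeries (map g xs)
  ΣSeries-cong []       p n = refl
  ΣSeries-cong (x ∷ xs) p n = cong₂ _+_ (p x n) (ΣSeries-cong xs p n)

  shift-ΣSeries : ∀ e fs → shift e (ΣSeries fs) ≗ ΣSeries (map (shift e) fs)
  shift-ΣSeries e []       = shift-0ˢ e
  shift-ΣSeries e (f ∷ fs) n = trans (shift-⊕ e f (ΣSeries fs) n) (cong (_+_ (shift e f n)) (shift-ΣSeries e fs n))

  ΣSeries-monomials-⊛ : ∀ {A : Set} xs (α : A → ℤ) (E : A → ℕ) X n →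
    (ΣSeries (map (λ x → monomial (α x) (E x)) xs) ⊛ X) n ≡ sumℤ (map (λ x → α x * shift (E x) X n) xs)
  ΣSeries-monomials-⊛ []       α E X n = 0ˢ-⊛ X n
  ΣSeries-monomials-⊛ (x ∷ xs) α E X n = trans (⊛-distribʳ-⊕ X (monomial (α x) (E x)) _ n)
    (cong₂ _+_ (monomial-⊛ (α x) (E x) X n) (ΣSeries-monomials-⊛ xs α E X n))

  oneMinus : ℕ → Series
  oneMinus m = one ⊕ monomial (- 1ℤ) m

  onePlus : ℕ → Series
  onePlus m = one ⊕ monomial 1ℤ m

  difference : ℕ → ℕ → Series
  difference d e = monomial 1ℤ d ⊕ monomial (- 1ℤ) e

  -- Σ_{t ≤ c < K} q^{c m}
  geomRange : ℕ → ℕ → ℕ → Series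
  geomRange K m t = ΣSeries (map (λ c → monomial (𝟙 (not (c <ᵇ t))) (c ℕ.* m)) (upTo K))

  telescoped : ℕ → ℕ → ℕ → Series
  telescoped K m t = if does (t <? K) then difference (t ℕ.* m) (K ℕ.* m) else 0ˢ

  monomial-⊛-oneMinus : ∀ e m → (monomial 1ℤ e ⊛ oneMinus m) ≗ difference e (e ℕ.+ m)
  monomial-⊛-oneMinus e m n = trans (⊛-distribˡ-⊕ (monomial 1ℤ e) one (monomial (- 1ℤ) m) n)
    (cong₂ _+_ (⊛-identityʳ (monomial 1ℤ e) n) (monomial-⊛-monomial 1ℤ (- 1ℤ) e m n))

  difference-trans : ∀ d e f → (difference d e ⊕ difference e f) ≗ difference d f
  difference-trans d e f n = begin
    (D + E) + (F + G)   ≡⟨ regroup D E F G ⟩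
    D + G + (E + F)     ≡⟨ cong (_+_ (D + G)) (trans (ℤP.+-comm E F) (monomial-cancel 1ℤ e n)) ⟩
    D + G + 0ℤ          ≡⟨ ℤP.+-identityʳ _ ⟩
    D + G               ∎
    where
    open ≡-Reasoning
    D = monomial 1ℤ d n
    E = monomial (- 1ℤ) e n
    F = monomial 1ℤ e n
    G = monomial (- 1ℤ) f n
    regroup : ∀ a b c d → (a + b) + (c + d) ≡ a + d + (b + c)
    regroup = solve-∀

  geomRange-suc : ∀ K m t → geomRange (suc K) m t ≗ (geomRange K m t ⊕ monomial (𝟙 (not (K <ᵇ t))) (K ℕ.* m))
  geomRange-suc K m t n = begin
    geomRange (suc K) m t n                                ≡⟨ cong (λ l → ΣSeries (map F l) n) (LP.upTo-∷ʳ K) ⟨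
    ΣSeries (map F (upTo K ++ K ∷ [])) n                   ≡⟨ cong (λ l → ΣSeries l n) (LP.map-++ F (upTo K) (K ∷ [])) ⟩
    ΣSeries (map F (upTo K) ++ F K ∷ []) n                 ≡⟨ ΣSeries-++ (map F (upTo K)) (F K ∷ []) n ⟩
    geomRange K m t n + (F K n + 0ℤ)                       ≡⟨ cong (_+_ (geomRange K m t n)) (ℤP.+-identityʳ (F K n)) ⟩
    geomRange K m t n + F K n                              ∎
    where
    open ≡-Reasoning
    F = λ c → monomial (𝟙 (not (c <ᵇ t))) (c ℕ.* m)

  telescoped-suc : ∀ K m t →
    (telescoped K m t ⊕ (monomial (𝟙 (not (K <ᵇ t))) (K ℕ.* m) ⊛ oneMinus m)) ≗ telescoped (suc K) m t
  telescoped-suc K m t n with ℕP.<-cmp t K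
  ... | tri< t<K _ _
    rewrite dec-true (t <? K) t<K | dec-true (t <? suc K) (ℕP.m<n⇒m<1+n t<K) | dec-false (K <? t) (ℕP.<⇒≯ t<K) =
    trans (cong (_+_ (difference (t ℕ.* m) (K ℕ.* m) n)) (monomial-⊛-oneMinus (K ℕ.* m) m n))
          (trans (difference-trans (t ℕ.* m) (K ℕ.* m) (K ℕ.* m ℕ.+ m) n)
                 (cong (λ e → monomial 1ℤ (t ℕ.* m) n + monomial (- 1ℤ) e n) (ℕP.+-comm (K ℕ.* m) m)))
  ... | tri≈ _ refl _
    rewrite dec-false (t <? t) (ℕP.<-irrefl refl) | dec-true (t <? suc t) (ℕP.n<1+n t) =
    trans (ℤP.+-identityˡ _) (trans (monomial-⊛-oneMinus (t ℕ.* m) m n)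
          (cong (λ e → monomial 1ℤ (t ℕ.* m) n + monomial (- 1ℤ) e n) (ℕP.+-comm (t ℕ.* m) m)))
  ... | tri> _ _ K<t
    rewrite dec-false (t <? K) (ℕP.<⇒≯ K<t) | dec-false (t <? suc K) (ℕP.≤⇒≯ K<t) | dec-true (K <? t) K<t =
    trans (ℤP.+-identityˡ _) (trans (⊛-congˡ (monomial-0ℤ (K ℕ.* m)) (oneMinus m) n) (0ˢ-⊛ (oneMinus m) n))

  geomRange-⊛-oneMinus : ∀ K m t → (geomRange K m t ⊛ oneMinus m) ≗ telescoped K m t
  geomRange-⊛-oneMinus zero    m t n = 0ˢ-⊛ (oneMinus m) n
  geomRange-⊛-oneMinus (suc K) m t n = begin
    (geomRange (suc K) m t ⊛ oneMinus m) n                                    ≡⟨ ⊛-congˡ (geomRange-suc K m t) (oneMinus m) n ⟩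
    ((geomRange K m t ⊕ monomial α (K ℕ.* m)) ⊛ oneMinus m) n                 ≡⟨ ⊛-distribʳ-⊕ (oneMinus m) (geomRange K m t) _ n ⟩
    (geomRange K m t ⊛ oneMinus m) n + (monomial α (K ℕ.* m) ⊛ oneMinus m) n  ≡⟨ cong (_+ (monomial α (K ℕ.* m) ⊛ oneMinus m) n) (geomRange-⊛-oneMinus K m t n) ⟩
    telescoped K m t n + (monomial α (K ℕ.* m) ⊛ oneMinus m) n                ≡⟨ telescoped-suc K m t n ⟩
    telescoped (suc K) m t n                                                  ∎
    where
    open ≡-Reasoning
    α = 𝟙 (not (K <ᵇ t))

  telescoped≈monomial : ∀ N m t → 1 ≤ m → telescoped (suc N) m t ≈[ N ] monomial 1ℤ (t ℕ.* m)
  telescoped≈monomial N m t 1≤m with t ℕ.≤? N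
  ... | yes t≤N rewrite dec-true (t <? suc N) (s≤s t≤N) =
    ≈-trans (⊕-cong≈ {f = monomial 1ℤ (t ℕ.* m)} ≈-refl (monomial-≈0ˢ (- 1ℤ) (suc N ℕ.* m) N N<[1+N]m))
            (≗⇒≈ (λ j → ℤP.+-identityʳ _))
    where
    N<[1+N]m : N < suc N ℕ.* m
    N<[1+N]m = ℕP.<-≤-trans (ℕP.n<1+n N) (ℕP.m≤m*n (suc N) m {{ℕ.>-nonZero 1≤m}})
  ... | no  t≰N rewrite dec-false (t <? suc N) (t≰N ∘ ℕP.≤-pred) =
    ≈-sym (monomial-≈0ˢ 1ℤ (t ℕ.* m) N (ℕP.<-≤-trans (ℕP.≰⇒> t≰N) (ℕP.m≤m*n t m {{ℕ.>-nonZero 1≤m}})))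

  plainLevel : ℕ → ℕ → (State → ℤ) → Series
  plainLevel N m α = ΣSeries (map (λ c → monomial (α (false , c)) (c ℕ.* m)) (upTo (suc N)))

  levelSeries-split : ∀ N m α → (∀ c → α (true , c) ≡ 1ℤ) →
    levelSeries N m α ≗ (plainLevel N m α ⊕ shift m (geomRange (suc N) m 0))
  levelSeries-split N m α α-over n = begin
    levelSeries N m α n
      ≡⟨ cong (λ l → ΣSeries l n) (LP.map-++ G (map (false ,_) cs) (map (true ,_) cs)) ⟩
    ΣSeries (map G (map (false ,_) cs) ++ map G (map (true ,_) cs)) n
      ≡⟨ ΣSeries-++ (map G (map (false ,_) cs)) _ n ⟩
    ΣSeries (map G (map (false ,_) cs)) n + ΣSeries (map G (map (true ,_) cs)) n
      ≡⟨ cong₂ _+_ (cong (λ l → ΣSeries l n) (sym (LP.map-∘ {g = G} cs))) overlined-part ⟩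
    plainLevel N m α n + shift m (geomRange (suc N) m 0) n
      ∎
    where
    open ≡-Reasoning
    cs = upTo (suc N)
    G = λ s → monomial (α s) (stateWeight m s)
    overlined-part : ΣSeries (map G (map (true ,_) cs)) n ≡ shift m (geomRange (suc N) m 0) n
    overlined-part = begin
      ΣSeries (map G (map (true ,_) cs)) n                                   ≡⟨ cong (λ l → ΣSeries l n) (sym (LP.map-∘ {g = G} cs)) ⟩
      ΣSeries (map (λ c → monomial (α (true , c)) (m ℕ.+ c ℕ.* m)) cs) n     ≡⟨ ΣSeries-cong cs (λ c j → cong (λ x → monomial x _ j) (α-over c)) n ⟩
      ΣSeries (map (λ c → monomial 1ℤ (m ℕ.+ c ℕ.* m)) cs) n                 ≡⟨ ΣSeries-cong cs (λ c → shift-monomial m (c ℕ.* m) 1ℤ) n ⟨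
      ΣSeries (map (shift m ∘ (λ c → monomial 1ℤ (c ℕ.* m))) cs) n           ≡⟨ cong (λ l → ΣSeries l n) (LP.map-∘ {g = shift m} cs) ⟩
      ΣSeries (map (shift m) (map (λ c → monomial 1ℤ (c ℕ.* m)) cs)) n       ≡⟨ shift-ΣSeries m (map (λ c → monomial 1ℤ (c ℕ.* m)) cs) n ⟨
      shift m (geomRange (suc N) m 0) n                                      ∎

  levelSeries-⊛-oneMinus : ∀ N m t α → 1 ≤ m → (∀ c → α (true , c) ≡ 1ℤ) → (∀ c → α (false , c) ≡ 𝟙 (not (c <ᵇ t))) →
    (levelSeries N m α ⊛ oneMinus m) ≈[ N ] (monomial 1ℤ (t ℕ.* m) ⊕ monomial 1ℤ m)
  levelSeries-⊛-oneMinus N m t α 1≤m α-over α-plain = begin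
    levelSeries N m α ⊛ Q                                   ≈⟨ ≗⇒≈ distributed ⟩
    (geomRange (suc N) m t ⊛ Q) ⊕ shift m (G₀ ⊛ Q)          ≈⟨ ⊕-cong≈ plain-part overlined-part ⟩
    monomial 1ℤ (t ℕ.* m) ⊕ monomial 1ℤ m                   ∎
    where
    open ≈-Reasoning N
    Q = oneMinus m
    G₀ = geomRange (suc N) m 0
    plain≗geomRange : plainLevel N m α ≗ geomRange (suc N) m t
    plain≗geomRange = ΣSeries-cong (upTo (suc N)) (λ c j → cong (λ x → monomial x (c ℕ.* m) j) (α-plain c))
    distributed : (levelSeries N m α ⊛ Q) ≗ ((geomRange (suc N) m t ⊛ Q) ⊕ shift m (G₀ ⊛ Q))
    distributed j = trans (⊛-congˡ (levelSeries-split N m α α-over) Q j)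
                          (trans (⊛-distribʳ-⊕ Q (plainLevel N m α) (shift m G₀) j)
                                 (cong₂ _+_ (⊛-congˡ plain≗geomRange Q j) (shift-⊛ m G₀ Q j)))
    plain-part : (geomRange (suc N) m t ⊛ Q) ≈[ N ] monomial 1ℤ (t ℕ.* m)
    plain-part = ≈-trans (≗⇒≈ (geomRange-⊛-oneMinus (suc N) m t)) (telescoped≈monomial N m t 1≤m)
    overlined-part : shift m (G₀ ⊛ Q) ≈[ N ] monomial 1ℤ m
    overlined-part = ≈-trans (shift-cong≈ m (≈-trans (≗⇒≈ (geomRange-⊛-oneMinus (suc N) m 0)) (telescoped≈monomial N m 0 1≤m)))
                             (≗⇒≈ (λ j → trans (shift-monomial m 0 1ℤ j) (cong (λ e → monomial 1ℤ e j) (ℕP.+-identityʳ m))))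

  oneMinus-coeff₀ : ∀ m → 1 ≤ m → oneMinus m 0 ≡ 1ℤ
  oneMinus-coeff₀ m = binomial-coeff₀ (- 1ℤ) m

  freeLevel-⊛-oneMinus : ∀ N m → 1 ≤ m → (freeLevel N m ⊛ oneMinus m) ≈[ N ] onePlus m
  freeLevel-⊛-oneMinus N m 1≤m = ≈-trans (levelSeries-⊛-oneMinus N m 0 (λ _ → 1ℤ) 1≤m (λ _ → refl) (λ _ → refl))
                                         (≗⇒≈ (⊕-cong (monomial-zero 1ℤ) (λ _ → refl)))

  blockedNumerator : ℕ → ℕ → Series
  blockedNumerator r m = monomial 1ℤ m ⊛ onePlus ((r ∸ 2) ℕ.* m)

  blockedNumerator-split : ∀ r m → 2 ≤ r → blockedNumerator r m ≗ (monomial 1ℤ ((r ∸ 1) ℕ.* m) ⊕ monomial 1ℤ m)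
  blockedNumerator-split (suc zero)    m (s≤s ())
  blockedNumerator-split (suc (suc r)) m _ n = begin
    blockedNumerator (2 ℕ.+ r) m n                                ≡⟨ ⊛-distribˡ-⊕ (monomial 1ℤ m) one (monomial 1ℤ (r ℕ.* m)) n ⟩
    (monomial 1ℤ m ⊛ one) n + (monomial 1ℤ m ⊛ monomial 1ℤ (r ℕ.* m)) n
                                                                  ≡⟨ cong₂ _+_ (⊛-identityʳ (monomial 1ℤ m) n) (monomial-⊛-monomial 1ℤ 1ℤ m (r ℕ.* m) n) ⟩
    monomial 1ℤ m n + monomial 1ℤ (suc r ℕ.* m) n                 ≡⟨ ℤP.+-comm (monomial 1ℤ m n) _ ⟩
    monomial 1ℤ (suc r ℕ.* m) n + monomial 1ℤ m n                 ∎
    where open ≡-Reasoning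

  blockedLevel-⊛-oneMinus : ∀ N r m → 2 ≤ r → 1 ≤ m → (blockedLevel N m (r ∸ 1) ⊛ oneMinus m) ≈[ N ] blockedNumerator r m
  blockedLevel-⊛-oneMinus N r m 2≤r 1≤m =
    ≈-trans (levelSeries-⊛-oneMinus N m (r ∸ 1) (𝟙 ∘ stateBlocked (r ∸ 1)) 1≤m (λ _ → refl) (λ _ → refl))
            (≗⇒≈ (λ j → sym (blockedNumerator-split r m 2≤r j)))

  -- Both sides are (1 + q^m) q^m (1 + q^{(r-2)m}) / (1 - q^m).
  blockedLevel-⊛-onePlus : ∀ N r m → 2 ≤ r → 1 ≤ m →
    (blockedLevel N m (r ∸ 1) ⊛ onePlus m) ≈[ N ] (freeLevel N m ⊛ blockedNumerator r m)
  blockedLevel-⊛-onePlus N r m 2≤r 1≤m = begin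
    blockedLevel N m (r ∸ 1) ⊛ onePlus m      ≈⟨ ⊛-cong≈ {g = onePlus m} blocked≈ ≈-refl ⟩
    (Z ⊛ inv (oneMinus m)) ⊛ onePlus m        ≈⟨ ≗⇒≈ (xy∙z≈zy∙x Z (inv (oneMinus m)) (onePlus m)) ⟩
    (onePlus m ⊛ inv (oneMinus m)) ⊛ Z        ≈⟨ ⊛-cong≈ {g = Z} (≈-sym free≈) ≈-refl ⟩
    freeLevel N m ⊛ Z                         ∎
    where
    open ≈-Reasoning N
    Z = blockedNumerator r m
    blocked≈ : blockedLevel N m (r ∸ 1) ≈[ N ] (Z ⊛ inv (oneMinus m))
    blocked≈ = quotient≈ (oneMinus-coeff₀ m 1≤m) (blockedLevel-⊛-oneMinus N r m 2≤r 1≤m)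
    free≈ : freeLevel N m ≈[ N ] (onePlus m ⊛ inv (oneMinus m))
    free≈ = quotient≈ (oneMinus-coeff₀ m 1≤m) (freeLevel-⊛-oneMinus N m 1≤m)

  overpartitionSeries : Series
  overpartitionSeries = qPochInf 1ℤ 1 1 ⊛ inv (qPochInf (- 1ℤ) 1 1)

  prodTo-freeLevel≈overpartitionSeries : ∀ N M → N ≤ M → prodTo M (freeLevel N) ≈[ N ] overpartitionSeries
  prodTo-freeLevel≈overpartitionSeries N M N≤M = begin
    prodTo M (freeLevel N)                                  ≈⟨ quotient≈ (prodTo-coeff₀ M oneMinus oneMinus-coeff₀) levels-⊛-oneMinus ⟩
    prodTo M onePlus ⊛ inv (prodTo M oneMinus)              ≈⟨ ⊛-cong≈ numerator≈ (inv-cong≈ (prodTo-coeff₀ M oneMinus oneMinus-coeff₀)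
                                                                                               (qPoch-coeff₀ (- 1ℤ) 1 1 1 ℕP.≤-refl) denominator≈) ⟩
    overpartitionSeries                                     ∎
    where
    open ≈-Reasoning N
    levels-⊛-oneMinus : (prodTo M (freeLevel N) ⊛ prodTo M oneMinus) ≈[ N ] prodTo M onePlus
    levels-⊛-oneMinus = ≈-trans (≗⇒≈ (λ j → sym (prodTo-∙ M (freeLevel N) oneMinus j)))
                                (prodTo-cong≈ M (λ m 1≤m _ → freeLevel-⊛-oneMinus N m 1≤m))
    numerator≈ : prodTo M onePlus ≈[ N ] qPochInf 1ℤ 1 1
    numerator≈ = ≈-trans (≗⇒≈ (λ j → sym (qPoch₁₁-as-prodTo 1ℤ M j))) (≈-sym (qPochInf≈qPoch 1ℤ N M N≤M))
    denominator≈ : prodTo M oneMinus ≈[ N ] qPochInf (- 1ℤ) 1 1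
    denominator≈ = ≈-trans (≗⇒≈ (λ j → sym (qPoch₁₁-as-prodTo (- 1ℤ) M j))) (≈-sym (qPochInf≈qPoch (- 1ℤ) N M N≤M))

module CandidateProducts (r A a : ℕ) (1≤a : 1 ≤ a) (1≤A : 1 ≤ A) (2≤r : 2 ≤ r) where

  open PowerSeries
  open Levels
  open Candidates A a 1≤a 1≤A
  open Products.OnCandidates ⊛-commutativeMonoid A a 1≤a 1≤A
  open import Data.Nat as ℕ using (zero; suc; _∸_; _<_)
  import Data.Nat.Properties as ℕP
  open import Data.Nat.Combinatorics using (_C_; nCk+nC[k+1]≡[n+1]C[k+1]; nC1≡n)
  open import Data.Integer using (1ℤ)
  open import Data.Bool using (true; false; if_then_else_)
  open import Relation.Binary.PropositionalEquality

  prodCandidates-onePlus : ∀ k → prodCandidates k onePlus ≗ qPoch 1ℤ a A k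
  prodCandidates-onePlus zero    = λ _ → refl
  prodCandidates-onePlus (suc k) j =
    trans (⊛-congˡ (prodCandidates-onePlus k) (onePlus (candidate k)) j) (sym (qPoch-suc 1ℤ a A k j))

  -- candidate 0 + ⋯ + candidate (k - 1)
  exponent : ℕ → ℕ
  exponent k = A ℕ.* (k C 2) ℕ.+ k ℕ.* a

  exponent-suc : ∀ k → exponent (suc k) ≡ exponent k ℕ.+ candidate k
  exponent-suc k = trans (cong (λ x → A ℕ.* x ℕ.+ suc k ℕ.* a) [1+k]C2) (ring A (k C 2) k a)
    where
    open import Data.Nat.Tactic.RingSolver using (solve-∀)
    [1+k]C2 : suc k C 2 ≡ k C 2 ℕ.+ k
    [1+k]C2 = trans (sym (nCk+nC[k+1]≡[n+1]C[k+1] k 1)) (trans (cong (ℕ._+ (k C 2)) (nC1≡n k)) (ℕP.+-comm k (k C 2)))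
    ring : ∀ A c k a → A ℕ.* (c ℕ.+ k) ℕ.+ (a ℕ.+ k ℕ.* a) ≡ A ℕ.* c ℕ.+ k ℕ.* a ℕ.+ (a ℕ.+ k ℕ.* A)
    ring = solve-∀

  extraFactors : ℕ → Series
  extraFactors k = qPoch 1ℤ ((r ∸ 2) ℕ.* a) ((r ∸ 2) ℕ.* A) k

  prodCandidates-blockedNumerator : ∀ k → prodCandidates k (blockedNumerator r) ≗ (monomial 1ℤ (exponent k) ⊛ extraFactors k)
  prodCandidates-blockedNumerator zero j = begin
    one j                                             ≡⟨ monomial-zero 1ℤ j ⟨
    monomial 1ℤ 0 j                                   ≡⟨ cong (λ e → monomial 1ℤ e j) (sym (trans (ℕP.+-identityʳ (A ℕ.* 0)) (ℕP.*-zeroʳ A))) ⟩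
    monomial 1ℤ (exponent 0) j                        ≡⟨ ⊛-identityʳ (monomial 1ℤ (exponent 0)) j ⟨
    (monomial 1ℤ (exponent 0) ⊛ extraFactors 0) j     ∎
    where open ≡-Reasoning
  prodCandidates-blockedNumerator (suc k) = begin
    prodCandidates k (blockedNumerator r) ⊛ (monomial 1ℤ c ⊛ onePlus ((r ∸ 2) ℕ.* c))
      ≈⟨ ⊛-congˡ (prodCandidates-blockedNumerator k) _ ⟩
    (monomial 1ℤ (exponent k) ⊛ extraFactors k) ⊛ (monomial 1ℤ c ⊛ onePlus ((r ∸ 2) ℕ.* c))
      ≈⟨ ⊛-interchange (monomial 1ℤ (exponent k)) (extraFactors k) (monomial 1ℤ c) _ ⟩
    (monomial 1ℤ (exponent k) ⊛ monomial 1ℤ c) ⊛ (extraFactors k ⊛ onePlus ((r ∸ 2) ℕ.* c))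
      ≈⟨ ⊛-cong (λ j → trans (monomial-⊛-monomial 1ℤ 1ℤ (exponent k) c j) (cong (λ e → monomial 1ℤ e j) (sym (exponent-suc k))))
                (⊛-congʳ (extraFactors k) (λ j → cong (λ e → (one ⊕ monomial 1ℤ e) j) (sym (distrib (r ∸ 2))))) ⟩
    monomial 1ℤ (exponent (suc k)) ⊛ (extraFactors k ⊛ (one ⊕ monomial 1ℤ ((r ∸ 2) ℕ.* a ℕ.+ k ℕ.* ((r ∸ 2) ℕ.* A))))
      ≈⟨ ⊛-congʳ (monomial 1ℤ (exponent (suc k))) (λ j → sym (qPoch-suc 1ℤ ((r ∸ 2) ℕ.* a) ((r ∸ 2) ℕ.* A) k j)) ⟩
    monomial 1ℤ (exponent (suc k)) ⊛ extraFactors (suc k)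
      ∎
    where
    open ≗-Reasoning
    open import Data.Nat.Tactic.RingSolver using (solve-∀)
    c = candidate k
    distrib : ∀ s → s ℕ.* a ℕ.+ k ℕ.* (s ℕ.* A) ≡ s ℕ.* c
    distrib s = ring s k a A
      where
      ring : ∀ s k a A → s ℕ.* a ℕ.+ k ℕ.* (s ℕ.* A) ≡ s ℕ.* (a ℕ.+ k ℕ.* A)
      ring = solve-∀

  constrainedLevel : ℕ → ℕ → ℕ → Series
  constrainedLevel N k m = if isCandidate k m then blockedLevel N m (r ∸ 1) else freeLevel N m

  constrainedLevel-⊛-onePlus : ∀ N k m → 1 ≤ m →
    (constrainedLevel N k m ⊛ onCandidates k onePlus m) ≈[ N ] (freeLevel N m ⊛ onCandidates k (blockedNumerator r) m)
  constrainedLevel-⊛-onePlus N k m 1≤m with isCandidate k m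
  ... | true  = blockedLevel-⊛-onePlus N r m 2≤r 1≤m
  ... | false = ≈-refl

  prodTo-constrainedLevel : ∀ N M k → N ≤ M → (∀ i → i < k → candidate i ≤ M) →
    prodTo M (constrainedLevel N k) ≈[ N ] (overpartitionSeries ⊛ term r A a k)
  prodTo-constrainedLevel N M k N≤M bounded = begin
    X                                         ≈⟨ quotient≈ (qPoch-coeff₀ 1ℤ a A k 1≤a) X⊛Q≈ ⟩
    (prodTo M (freeLevel N) ⊛ (q^e ⊛ R)) ⊛ inv Q
                                              ≈⟨ ⊛-cong≈ {g = inv Q} (⊛-cong≈ {g = q^e ⊛ R} (prodTo-freeLevel≈overpartitionSeries N M N≤M) ≈-refl) ≈-refl ⟩
    (overpartitionSeries ⊛ (q^e ⊛ R)) ⊛ inv Q ≈⟨ ≗⇒≈ (λ j → trans (⊛-assoc overpartitionSeries (q^e ⊛ R) (inv Q) j)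
                                                                 (⊛-congʳ overpartitionSeries (xy∙z≈xz∙y q^e R (inv Q)) j)) ⟩
    overpartitionSeries ⊛ term r A a k        ∎
    where
    open ≈-Reasoning N
    X = prodTo M (constrainedLevel N k)
    Q = qPoch 1ℤ a A k
    q^e = monomial 1ℤ (exponent k)
    R = extraFactors k
    X⊛Q≈ : (X ⊛ Q) ≈[ N ] (prodTo M (freeLevel N) ⊛ (q^e ⊛ R))
    X⊛Q≈ = begin
      X ⊛ Q                                                   ≈⟨ ≗⇒≈ (⊛-congʳ X (λ j → sym (trans (prodTo-onCandidates M k onePlus bounded j) (prodCandidates-onePlus k j)))) ⟩
      X ⊛ prodTo M (onCandidates k onePlus)                   ≈⟨ ≗⇒≈ (λ j → sym (prodTo-∙ M (constrainedLevel N k) (onCandidates k onePlus) j)) ⟩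
      prodTo M (λ m → constrainedLevel N k m ⊛ onCandidates k onePlus m)
                                                              ≈⟨ prodTo-cong≈ M (λ m 1≤m _ → constrainedLevel-⊛-onePlus N k m 1≤m) ⟩
      prodTo M (λ m → freeLevel N m ⊛ onCandidates k (blockedNumerator r) m)
                                                              ≈⟨ ≗⇒≈ (prodTo-∙ M (freeLevel N) (onCandidates k (blockedNumerator r))) ⟩
      prodTo M (freeLevel N) ⊛ prodTo M (onCandidates k (blockedNumerator r))
                                                              ≈⟨ ≗⇒≈ (⊛-congʳ (prodTo M (freeLevel N)) (λ j → trans (prodTo-onCandidates M k (blockedNumerator r) bounded j)
                                                                                                                    (prodCandidates-blockedNumerator k j))) ⟩
      prodTo M (freeLevel N) ⊛ (q^e ⊛ R)                      ∎

module Overpartitions where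

  open Levels using (State; stateWeight; states)
  open import Data.Nat as ℕ using (zero; suc; _+_; _*_; _∸_; _<_; _≤ᵇ_; z≤n; s≤s)
  import Data.Nat.Properties as ℕP
  open import Data.Nat.ListAction using (sum)
  open import Data.Nat.ListAction.Properties using (sum-++)
  open import Data.List using ([]; _∷_; _++_; map; replicate; concatMap; head; upTo)
  import Data.List.Properties as LP
  open import Data.Bool using (true; false; if_then_else_; not; _∧_; _∨_)
  import Data.Bool.Properties as BP
  open import Data.Product using (proj₁; proj₂)
  open import Data.Sum using (inj₁; inj₂)
  import Data.Maybe as Maybe
  open import Data.Maybe.Relation.Binary.Connected using (Connected; just; just-nothing)
  open import Data.List.Relation.Unary.All using (All; []; _∷_)
  import Data.List.Relation.Unary.All as All
  import Data.List.Relation.Unary.All.Properties as AllP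
  open import Data.List.Relation.Unary.Linked using (Linked; []; _∷_; _∷′_)
  import Data.List.Relation.Unary.Linked as Linked
  open import Relation.Nullary using (does; yes; no; contradiction)
  open import Data.List.Membership.Propositional using (_∈_; lose)
  open import Data.List.Membership.Propositional.Properties using (∈-map⁺; ∈-map⁻; ∈-concatMap⁺; ∈-concatMap⁻; ∈-upTo⁺; ∈-++⁺ˡ; ∈-++⁺ʳ)
  open import Data.List.Relation.Unary.Any using (Any; here)
  import Data.List.Relation.Unary.Any as Any
  open import Data.List.Relation.Unary.Unique.Propositional using (Unique; []; _∷_)
  import Data.List.Relation.Unary.Unique.Propositional.Properties as UniqueP
  import Data.List.Relation.Unary.AllPairs as AllPairs
  import Data.List.Relation.Unary.AllPairs.Properties as AllPairsP
  open import Data.List.Relation.Binary.Disjoint.Propositional using (Disjoint)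
  open import Relation.Nullary.Decidable using (dec-true; dec-false)
  open import Relation.Binary.PropositionalEquality
  open import Function.Bundles using (mk⇔)
  open import Function.Properties.Equivalence using () renaming (trans to ⇔-trans; sym to ⇔-sym)
  open import Data.List.Relation.Binary.Permutation.Propositional using (_↭_)
  open import Data.List.Relation.Binary.BagAndSetEquality using (∼bag⇒↭)
  open import Data.List.Membership.Propositional.Properties.WithK using (unique∧set⇒bag)

  Below : ℕ → List Part → Set
  Below m = All (λ p → proj₁ p < m)

  plainCopies : ℕ → ℕ → List Part
  plainCopies m c = replicate c (m , false)

  block : ℕ → State → List Part
  block m (true  , c) = (m , true) ∷ plainCopies m c
  block m (false , c) = plainCopies m c

  weight-++ : ∀ π π' → weight (π ++ π') ≡ weight π + weight π'
  weight-++ π π' = trans (cong sum (LP.map-++ proj₁ π π')) (sum-++ (map proj₁ π) (map proj₁ π'))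

  weight-block : ∀ m s → weight (block m s) ≡ stateWeight m s
  weight-block m (true  , c) = cong (_+_ m) (weight-plainCopies c)
    where
    weight-plainCopies : ∀ c → weight (plainCopies m c) ≡ c * m
    weight-plainCopies zero    = refl
    weight-plainCopies (suc c) = cong (_+_ m) (weight-plainCopies c)
  weight-block m (false , zero)  = refl
  weight-block m (false , suc c) = weight-block m (true , c)

  All-block : ∀ {P : Part → Set} m s → (∀ o → P (m , o)) → All P (block m s)
  All-block m (true  , c) p = p true ∷ AllP.replicate⁺ c (p false)
  All-block m (false , c) p = AllP.replicate⁺ c (p false)

  head-after-plainCopies : ∀ m o c π → Below m π → Connected Adj (Maybe.just (m , o)) (head (plainCopies m c ++ π))
  head-after-plainCopies m o (suc c) π       _         = just (inj₂ (refl , refl))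
  head-after-plainCopies m o zero    []      _         = just-nothing
  head-after-plainCopies m o zero    (_ ∷ _) (p<m ∷ _) = just (inj₁ p<m)

  linked-plainCopies-++ : ∀ m c π → Below m π → Linked Adj π → Linked Adj (plainCopies m c ++ π)
  linked-plainCopies-++ m zero    π below l = l
  linked-plainCopies-++ m (suc c) π below l =
    head-after-plainCopies m false c π below ∷′ linked-plainCopies-++ m c π below l

  linked-block-++ : ∀ m s π → Below m π → Linked Adj π → Linked Adj (block m s ++ π)
  linked-block-++ m (true  , c) π below l = head-after-plainCopies m true c π below ∷′ linked-plainCopies-++ m c π below l
  linked-block-++ m (false , c) π below l = linked-plainCopies-++ m c π below l

  adj⇒≥ : ∀ {p q} → Adj p q → proj₁ q ≤ proj₁ p
  adj⇒≥ (inj₁ q<p)       = ℕP.<⇒≤ q<p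
  adj⇒≥ (inj₂ (q≡p , _)) = ℕP.≤-reflexive q≡p

  linked-descending : ∀ p π → Linked Adj (p ∷ π) → All (λ q → proj₁ q ≤ proj₁ p) π
  linked-descending p []      _         = []
  linked-descending p (q ∷ π) (pq ∷ l) =
    q≤p ∷ All.map (λ u≤q → ℕP.≤-trans u≤q q≤p) (linked-descending q π l)
    where q≤p = adj⇒≥ {p} {q} pq

  below-head : ∀ m p π → proj₁ p < m → Linked Adj (p ∷ π) → Below m (p ∷ π)
  below-head m p π p<m l = p<m ∷ All.map (λ q≤p → ℕP.≤-<-trans q≤p p<m) (linked-descending p π l)

  plainCopies-prefix : ∀ m o π → Linked Adj ((m , o) ∷ π) →
    Σ[ c ∈ ℕ ] Σ[ π' ∈ List Part ] (π ≡ plainCopies m c ++ π' × Below m π')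
  plainCopies-prefix m o []                 _                 = 0 , [] , refl , []
  plainCopies-prefix m o ((v , o') ∷ π)     (inj₁ v<m ∷ l)    = 0 , _ , refl , below-head m (v , o') π v<m l
  plainCopies-prefix m o ((v , o') ∷ π)     (inj₂ (refl , refl) ∷ l) with plainCopies-prefix m false π l
  ... | c , π' , refl , below = suc c , π' , refl , below

  decompose : ∀ m π → Linked Adj π → All (λ p → proj₁ p ≤ m) π →
    Σ[ s ∈ State ] Σ[ π' ∈ List Part ] (π ≡ block m s ++ π' × Below m π')
  decompose m []            l _          = (false , 0) , [] , refl , []
  decompose m ((v , o) ∷ π) l (v≤m ∷ _) with ℕP.m≤n⇒m<n∨m≡n v≤m
  ... | inj₁ v<m  = (false , 0) , _ , refl , below-head m (v , o) π v<m l
  ... | inj₂ refl with plainCopies-prefix v o π l | o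
  ...   | c , π' , refl , below | true  = (true , c) , π' , refl , below
  ...   | c , π' , refl , below | false = (false , suc c) , π' , refl , below

  hasOver-++ : ∀ v π π' → hasOver v (π ++ π') ≡ hasOver v π ∨ hasOver v π'
  hasOver-++ v []      π' = refl
  hasOver-++ v (p ∷ π) π' = trans (cong (_ ∨_) (hasOver-++ v π π')) (sym (BP.∨-assoc _ (hasOver v π) (hasOver v π')))

  countPlain-++ : ∀ v π π' → countPlain v (π ++ π') ≡ countPlain v π + countPlain v π'
  countPlain-++ v []      π' = refl
  countPlain-++ v (p ∷ π) π' = trans (cong (_+_ (if does (proj₁ p ℕ.≟ v) ∧ not (proj₂ p) then 1 else 0)) (countPlain-++ v π π')) (sym (ℕP.+-assoc _ (countPlain v π) (countPlain v π')))

  hasOver-below : ∀ m π → Below m π → hasOver m π ≡ false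
  hasOver-below m []            _          = refl
  hasOver-below m ((v , o) ∷ π) (v<m ∷ b) rewrite dec-false (v ℕ.≟ m) (ℕP.<⇒≢ v<m) = hasOver-below m π b

  countPlain-below : ∀ m π → Below m π → countPlain m π ≡ 0
  countPlain-below m []            _          = refl
  countPlain-below m ((v , o) ∷ π) (v<m ∷ b) rewrite dec-false (v ℕ.≟ m) (ℕP.<⇒≢ v<m) = countPlain-below m π b

  hasOver-plainCopies : ∀ v m c → hasOver v (plainCopies m c) ≡ false
  hasOver-plainCopies v m zero    = refl
  hasOver-plainCopies v m (suc c) rewrite BP.∧-zeroʳ (does (m ℕ.≟ v)) = hasOver-plainCopies v m c

  countPlain-plainCopies-≢ : ∀ v m c → m ≢ v → countPlain v (plainCopies m c) ≡ 0
  countPlain-plainCopies-≢ v m zero    m≢v = refl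
  countPlain-plainCopies-≢ v m (suc c) m≢v rewrite dec-false (m ℕ.≟ v) m≢v = countPlain-plainCopies-≢ v m c m≢v

  countPlain-plainCopies : ∀ m c → countPlain m (plainCopies m c) ≡ c
  countPlain-plainCopies m zero    = refl
  countPlain-plainCopies m (suc c) rewrite dec-true (m ℕ.≟ m) refl = cong suc (countPlain-plainCopies m c)

  hasOver-block-≢ : ∀ v m s → m ≢ v → hasOver v (block m s) ≡ false
  hasOver-block-≢ v m (true  , c) m≢v rewrite dec-false (m ℕ.≟ v) m≢v = hasOver-plainCopies v m c
  hasOver-block-≢ v m (false , c) m≢v = hasOver-plainCopies v m c

  countPlain-block-≢ : ∀ v m s → m ≢ v → countPlain v (block m s) ≡ 0
  countPlain-block-≢ v m (true  , c) m≢v rewrite dec-false (m ℕ.≟ v) m≢v = countPlain-plainCopies-≢ v m c m≢v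
  countPlain-block-≢ v m (false , c) m≢v = countPlain-plainCopies-≢ v m c m≢v

  hasOver-block : ∀ m s → hasOver m (block m s) ≡ proj₁ s
  hasOver-block m (true  , c) rewrite dec-true (m ℕ.≟ m) refl = refl
  hasOver-block m (false , c) = hasOver-plainCopies m m c

  countPlain-block : ∀ m s → countPlain m (block m s) ≡ proj₂ s
  countPlain-block m (true  , c) rewrite dec-true (m ℕ.≟ m) refl = countPlain-plainCopies m c
  countPlain-block m (false , c) = countPlain-plainCopies m c

  stateAt : ℕ → List Part → State
  stateAt m π = hasOver m π , countPlain m π

  stateAt-block-++ : ∀ m s π → Below m π → stateAt m (block m s ++ π) ≡ s
  stateAt-block-++ m s π below
    rewrite hasOver-++ m (block m s) π | countPlain-++ m (block m s) π | hasOver-block m s | countPlain-block m s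
          | hasOver-below m π below | countPlain-below m π below | BP.∨-identityʳ (proj₁ s) | ℕP.+-identityʳ (proj₂ s) = refl

  stateAt-block-≢-++ : ∀ v m s π → m ≢ v → stateAt v (block m s ++ π) ≡ stateAt v π
  stateAt-block-≢-++ v m s π m≢v
    rewrite hasOver-++ v (block m s) π | countPlain-++ v (block m s) π
          | hasOver-block-≢ v m s m≢v | countPlain-block-≢ v m s m≢v = refl

  -- Overpartitions of n with parts ≤ M and at most N plain copies of each part.
  overpartitions : ℕ → ℕ → ℕ → List (List Part)
  withTopBlock : ℕ → ℕ → ℕ → State → List (List Part)

  overpartitions N zero    zero    = [] ∷ []
  overpartitions N zero    (suc n) = []
  overpartitions N (suc M) n       = concatMap (withTopBlock N M n) (states N)

  withTopBlock N M n s =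
    if stateWeight (suc M) s ≤ᵇ n
    then map (block (suc M) s ++_) (overpartitions N M (n ∸ stateWeight (suc M) s))
    else []

  BoundedOverpartition : ℕ → ℕ → List Part → Set
  BoundedOverpartition M n π = IsOverpartition n π × All (λ p → proj₁ p ≤ M) π

  ∈-withTopBlock⁻ : ∀ N M n s π → π ∈ withTopBlock N M n s →
    stateWeight (suc M) s ≤ n × Σ[ π' ∈ List Part ] (π' ∈ overpartitions N M (n ∸ stateWeight (suc M) s) × π ≡ block (suc M) s ++ π')
  ∈-withTopBlock⁻ N M n s π π∈ with stateWeight (suc M) s ℕ.≤? n
  ... | no  w≰n rewrite dec-false (stateWeight (suc M) s ℕ.≤? n) w≰n = contradiction π∈ λ ()
  ... | yes w≤n rewrite dec-true  (stateWeight (suc M) s ℕ.≤? n) w≤n with ∈-map⁻ (block (suc M) s ++_) π∈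
  ...   | π' , π'∈ , refl = w≤n , π' , π'∈ , refl

  ∈-withTopBlock⁺ : ∀ N M n s π → stateWeight (suc M) s ≤ n → π ∈ overpartitions N M (n ∸ stateWeight (suc M) s) →
    (block (suc M) s ++ π) ∈ withTopBlock N M n s
  ∈-withTopBlock⁺ N M n s π w≤n π∈ rewrite dec-true (stateWeight (suc M) s ℕ.≤? n) w≤n = ∈-map⁺ (block (suc M) s ++_) π∈

  overpartitions-sound : ∀ N M n π → π ∈ overpartitions N M n → BoundedOverpartition M n π
  overpartitions-sound N zero zero .[] (here refl) = ([] , [] , refl) , []
  overpartitions-sound N (suc M) n π π∈ with Any.satisfied (∈-concatMap⁻ (withTopBlock N M n) {xs = states N} π∈)
  ... | s , π∈s with ∈-withTopBlock⁻ N M n s π π∈s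
  ...   | w≤n , π' , π'∈ , refl with overpartitions-sound N M (n ∸ stateWeight (suc M) s) π' π'∈
  ...     | (positive , linked , weight≡) , bounded =
    ( AllP.++⁺ (All-block (suc M) s (λ _ → s≤s z≤n)) positive
    , linked-block-++ (suc M) s π' (All.map s≤s bounded) linked
    , trans (weight-++ (block (suc M) s) π') (trans (cong₂ _+_ (weight-block (suc M) s) weight≡) (ℕP.m+[n∸m]≡n w≤n)) )
    , AllP.++⁺ (All-block (suc M) s (λ _ → ℕP.≤-refl)) (All.map ℕP.m≤n⇒m≤1+n bounded)

  ∈-states : ∀ N o c → c ≤ N → (o , c) ∈ states N
  ∈-states N false c c≤N = ∈-++⁺ˡ (∈-map⁺ (false ,_) (∈-upTo⁺ (s≤s c≤N)))
  ∈-states N true  c c≤N = ∈-++⁺ʳ (map (false ,_) (upTo (suc N))) (∈-map⁺ (true ,_) (∈-upTo⁺ (s≤s c≤N)))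

  plainCount≤stateWeight : ∀ m o c → 1 ≤ m → c ≤ stateWeight m (o , c)
  plainCount≤stateWeight m false c 1≤m = ℕP.m≤m*n c m {{ℕ.>-nonZero 1≤m}}
  plainCount≤stateWeight m true  c 1≤m = ℕP.≤-trans (ℕP.n≤1+n c) (ℕP.m≤m*n (suc c) m {{ℕ.>-nonZero 1≤m}})

  overpartitions-complete : ∀ N M n π → BoundedOverpartition M n π → n ≤ N → π ∈ overpartitions N M n
  overpartitions-complete N zero    n []      ((_ , _ , refl) , _)     _ = here refl
  overpartitions-complete N zero    n (p ∷ π) ((1≤p ∷ _ , _) , p≤0 ∷ _) _ = contradiction (ℕP.≤-trans 1≤p p≤0) λ ()
  overpartitions-complete N (suc M) n π ((positive , linked , weight≡) , bounded) n≤N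
    with decompose (suc M) π linked bounded
  ... | (o , c) , π' , refl , below =
    ∈-concatMap⁺ (withTopBlock N M n) (lose (∈-states N o c c≤N)
      (∈-withTopBlock⁺ N M n (o , c) π' w≤n
        (overpartitions-complete N M (n ∸ w) π'
          ((AllP.++⁻ʳ (block (suc M) (o , c)) positive , linked-suffix (block (suc M) (o , c)) linked , weight-rest)
           , All.map ℕP.≤-pred below)
          (ℕP.≤-trans (ℕP.m∸n≤m n w) n≤N))))
    where
    w = stateWeight (suc M) (o , c)
    w+weight≡n : w + weight π' ≡ n
    w+weight≡n = trans (cong (_+ weight π') (sym (weight-block (suc M) (o , c))))
                       (trans (sym (weight-++ (block (suc M) (o , c)) π')) weight≡)
    w≤n : w ≤ n
    w≤n = ℕP.≤-trans (ℕP.m≤m+n w (weight π')) (ℕP.≤-reflexive w+weight≡n)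
    weight-rest : weight π' ≡ n ∸ w
    weight-rest = sym (trans (cong (_∸ w) (sym w+weight≡n)) (ℕP.m+n∸m≡n w (weight π')))
    c≤N : c ≤ N
    c≤N = ℕP.≤-trans (plainCount≤stateWeight (suc M) o c (s≤s z≤n)) (ℕP.≤-trans w≤n n≤N)
    linked-suffix : ∀ π {π'} → Linked Adj (π ++ π') → Linked Adj π'
    linked-suffix []      l = l
    linked-suffix (_ ∷ π) l = linked-suffix π (Linked.tail l)

  states-unique : ∀ N → Unique (states N)
  states-unique N = UniqueP.++⁺ (UniqueP.map⁺ (λ { refl → refl }) (UniqueP.upTo⁺ (suc N)))
                                (UniqueP.map⁺ (λ { refl → refl }) (UniqueP.upTo⁺ (suc N)))
                                disjoint
    where
    disjoint : Disjoint (map (false ,_) (upTo (suc N))) (map (true ,_) (upTo (suc N)))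
    disjoint (∈false , ∈true) with ∈-map⁻ (false ,_) ∈false | ∈-map⁻ (true ,_) ∈true
    ... | _ , _ , refl | _ , _ , ()

  stateAt-withTopBlock : ∀ N M n s π → π ∈ withTopBlock N M n s → stateAt (suc M) π ≡ s
  stateAt-withTopBlock N M n s π π∈ with ∈-withTopBlock⁻ N M n s π π∈
  ... | _ , π' , π'∈ , refl = stateAt-block-++ (suc M) s π' (All.map s≤s (proj₂ (overpartitions-sound N M _ π' π'∈)))

  overpartitions-unique : ∀ N M n → Unique (overpartitions N M n)
  overpartitions-unique N zero    zero    = [] ∷ []
  overpartitions-unique N zero    (suc n) = []
  overpartitions-unique N (suc M) n = UniqueP.concat⁺
    (AllP.map⁺ (All.universal withTopBlock-unique (states N)))
    (AllPairsP.map⁺ (AllPairs.map disjoint (states-unique N)))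
    where
    withTopBlock-unique : ∀ s → Unique (withTopBlock N M n s)
    withTopBlock-unique s with stateWeight (suc M) s ≤ᵇ n
    ... | true  = UniqueP.map⁺ (λ {π} {π'} → LP.++-cancelˡ (block (suc M) s) π π')
                               (overpartitions-unique N M (n ∸ stateWeight (suc M) s))
    ... | false = []
    disjoint : ∀ {s s'} → s ≢ s' → Disjoint (withTopBlock N M n s) (withTopBlock N M n s')
    disjoint {s} {s'} s≢s' {π} (∈s , ∈s') =
      s≢s' (trans (sym (stateAt-withTopBlock N M n s π ∈s)) (stateAt-withTopBlock N M n s' π ∈s'))

  part≤weight : ∀ π → All (λ p → proj₁ p ≤ weight π) π
  part≤weight []      = []
  part≤weight (p ∷ π) = ℕP.m≤m+n (proj₁ p) (weight π) ∷ All.map (λ q≤ → ℕP.≤-trans q≤ (ℕP.m≤n+m (weight π) (proj₁ p))) (part≤weight π)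

  overpartitions-enumerate : ∀ n M → n ≤ M → Enumerates n (overpartitions n M n)
  overpartitions-enumerate n M n≤M = overpartitions-unique n M n , λ π → mk⇔
    (λ π∈ → proj₁ (overpartitions-sound n M n π π∈))
    (λ { overpartition@(_ , _ , weight≡) →
         overpartitions-complete n M n π
           (overpartition , All.map (λ p≤ → ℕP.≤-trans p≤ (ℕP.≤-trans (ℕP.≤-reflexive weight≡) n≤M)) (part≤weight π))
           ℕP.≤-refl })

  enumerations-↭ : ∀ {n Ls Ks} → Enumerates n Ls → Enumerates n Ks → Ls ↭ Ks
  enumerations-↭ (unique-Ls , ∈Ls) (unique-Ks , ∈Ks) =
    ∼bag⇒↭ (unique∧set⇒bag unique-Ls unique-Ks (λ {π} → ⇔-trans (∈Ls π) (⇔-sym (∈Ks π))))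

module Counting (r A a : ℕ) (1≤a : 1 ≤ a) (1≤A : 1 ≤ A) (2≤r : 2 ≤ r) where

  open PowerSeries
  open Levels
  open Overpartitions
  open Candidates A a 1≤a 1≤A
  open CandidateProducts r A a 1≤a 1≤A 2≤r using (constrainedLevel)
  open import Data.Bool.Properties using (∧-commutativeMonoid)
  open import Data.Product using (proj₁; proj₂; ∃₂)
  open import Data.Sum using (inj₁; inj₂)
  module ∧ = Products ∧-commutativeMonoid
  module ∧Candidates = Products.OnCandidates ∧-commutativeMonoid A a 1≤a 1≤A
  open import Data.Nat as ℕ using (zero; suc; _∸_; _<_; z≤n; s≤s)
  import Data.Nat.Properties as ℕP
  open import Data.Integer using (ℤ; _*_)
  import Data.Integer.Properties as ℤP
  open import Data.Bool using (Bool; true; false; if_then_else_; not; _∧_)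
  open import Data.List using ([]; _∷_; _++_; map)
  import Data.List.Properties as LP
  open import Data.List.Relation.Unary.All using (All; []; _∷_)
  import Data.List.Relation.Unary.All as All
  open import Data.List.Membership.Propositional using (_∈_)
  open import Relation.Nullary using (yes; no)
  open import Relation.Nullary.Decidable using (dec-true; dec-false)
  open import Relation.Binary.PropositionalEquality
  open import Relation.Nullary using (¬_; contradiction)
  open import Data.List using (length; lookup)
  open import Data.List.Relation.Unary.Any using (Any; here; there)
  import Data.List.Relation.Unary.Any as Any
  open import Data.List.Relation.Unary.Any.Properties using (lookup-index)
  open import Data.Fin as Fin using (Fin; toℕ)
  open import Data.Fin.Properties using (pigeonhole; toℕ<n)
  open IntegerSums using (sum-map-*ˡ)

  -- Definitionally equal to stateBlocked (r ∸ 1) (stateAt m π).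
  blocked : ℕ → List Part → Bool
  blocked m π = not (free r π m)

  -- Each of the first k candidates that is ≤ M is blocked in π.
  constraintsHold : ℕ → ℕ → List Part → Bool
  constraintsHold k M π = ∧.prodTo M (∧Candidates.onCandidates k (λ m → blocked m π))

  levelWeight : ℕ → ℕ → State → ℤ
  levelWeight k m s = 𝟙 (if isCandidate k m then stateBlocked (r ∸ 1) s else true)

  𝟙-∧ : ∀ x y → 𝟙 (x ∧ y) ≡ 𝟙 x * 𝟙 y
  𝟙-∧ true  y = sym (ℤP.*-identityˡ (𝟙 y))
  𝟙-∧ false y = refl

  constraintsHold-block-++ : ∀ k M s π → Below (suc M) π →
    𝟙 (constraintsHold k (suc M) (block (suc M) s ++ π)) ≡ levelWeight k (suc M) s * 𝟙 (constraintsHold k M π)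
  constraintsHold-block-++ k M s π below =
    trans (𝟙-∧ (atLevel (suc M) (stateAt (suc M) (block (suc M) s ++ π))) _) (cong₂ (λ x y → 𝟙 x * 𝟙 y) top rest)
    where
    atLevel : ℕ → State → Bool
    atLevel m s = if isCandidate k m then stateBlocked (r ∸ 1) s else true
    top : atLevel (suc M) (stateAt (suc M) (block (suc M) s ++ π)) ≡ atLevel (suc M) s
    top = cong (atLevel (suc M)) (stateAt-block-++ (suc M) s π below)
    rest : ∧.prodTo M (λ m → atLevel m (stateAt m (block (suc M) s ++ π))) ≡ ∧.prodTo M (λ m → atLevel m (stateAt m π))
    rest = ∧.prodTo-cong M (λ m _ m≤M → cong (atLevel m) (stateAt-block-≢-++ m (suc M) s π (ℕP.>⇒≢ (s≤s m≤M))))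

  module _ (N : ℕ) where

    count : ℕ → ℕ → Series
    count k M j = sumℤ (map (λ π → 𝟙 (constraintsHold k M π)) (overpartitions N M j))

    withTopBlock-count : ∀ k M j s →
      sumℤ (map (λ π → 𝟙 (constraintsHold k (suc M) π)) (withTopBlock N M j s))
        ≡ levelWeight k (suc M) s * shift (stateWeight (suc M) s) (count k M) j
    withTopBlock-count k M j s with stateWeight (suc M) s ℕ.≤? j
    ... | no  w≰j rewrite dec-false (stateWeight (suc M) s ℕ.≤? j) w≰j =
      sym (trans (cong (levelWeight k (suc M) s *_) (shift-< (stateWeight (suc M) s) (count k M) j (ℕP.≰⇒> w≰j)))
                 (ℤP.*-zeroʳ (levelWeight k (suc M) s)))
    ... | yes w≤j rewrite dec-true (stateWeight (suc M) s ℕ.≤? j) w≤j = begin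
      sumℤ (map W₊ (map (block (suc M) s ++_) rest))                   ≡⟨ cong sumℤ (LP.map-∘ rest) ⟨
      sumℤ (map (λ π → W₊ (block (suc M) s ++ π)) rest)                ≡⟨ ℤΣ.sum-map-cong rest (All.tabulate step) ⟩
      sumℤ (map (λ π → levelWeight k (suc M) s * W π) rest)            ≡⟨ sum-map-*ˡ (levelWeight k (suc M) s) W rest ⟩
      levelWeight k (suc M) s * count k M (j ∸ stateWeight (suc M) s)  ≡⟨ cong (levelWeight k (suc M) s *_) (shift-≥ (stateWeight (suc M) s) (count k M) j w≤j) ⟨
      levelWeight k (suc M) s * shift (stateWeight (suc M) s) (count k M) j ∎
      where
      open ≡-Reasoning
      rest = overpartitions N M (j ∸ stateWeight (suc M) s)
      W₊ = λ π → 𝟙 (constraintsHold k (suc M) π)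
      W = λ π → 𝟙 (constraintsHold k M π)
      step : ∀ {π} → π ∈ rest → W₊ (block (suc M) s ++ π) ≡ levelWeight k (suc M) s * W π
      step {π} π∈ = constraintsHold-block-++ k M s π (All.map s≤s (proj₂ (overpartitions-sound N M _ π π∈)))

    count-suc : ∀ k M → count k (suc M) ≗ (levelSeries N (suc M) (levelWeight k (suc M)) ⊛ count k M)
    count-suc k M j = begin
      count k (suc M) j
        ≡⟨ ℤΣ.sum-concatMap (λ π → 𝟙 (constraintsHold k (suc M) π)) (withTopBlock N M j) (states N) ⟩
      sumℤ (map (λ s → sumℤ (map (λ π → 𝟙 (constraintsHold k (suc M) π)) (withTopBlock N M j s))) (states N))
        ≡⟨ cong sumℤ (LP.map-cong (withTopBlock-count k M j) (states N)) ⟩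
      sumℤ (map (λ s → levelWeight k (suc M) s * shift (stateWeight (suc M) s) (count k M) j) (states N))
        ≡⟨ ΣSeries-monomials-⊛ (states N) (levelWeight k (suc M)) (stateWeight (suc M)) (count k M) j ⟨
      (levelSeries N (suc M) (levelWeight k (suc M)) ⊛ count k M) j
        ∎
      where open ≡-Reasoning

    levelSeries-levelWeight : ∀ k m → levelSeries N m (levelWeight k m) ≗ constrainedLevel N k m
    levelSeries-levelWeight k m with isCandidate k m
    ... | true  = λ _ → refl
    ... | false = λ _ → refl

    count≗prodTo : ∀ k M → count k M ≗ prodTo M (constrainedLevel N k)
    count≗prodTo k zero    zero    = refl
    count≗prodTo k zero    (suc j) = refl
    count≗prodTo k (suc M) j = trans (count-suc k M j) (⊛-cong (levelSeries-levelWeight k (suc M)) (count≗prodTo k M) j)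

  firstBlocked : ℕ → List Part → Bool
  firstBlocked k π = ∧Candidates.prodCandidates k (λ m → blocked m π)

  constraintsHold≡firstBlocked : ∀ k M π → (∀ i → i < k → candidate i ≤ M) → constraintsHold k M π ≡ firstBlocked k π
  constraintsHold≡firstBlocked k M π = ∧Candidates.prodTo-onCandidates M k (λ m → blocked m π)

  firstBlocked-false-mono : ∀ π {K K'} → K ≤ K' → firstBlocked K π ≡ false → firstBlocked K' π ≡ false
  firstBlocked-false-mono π {K} {K'} K≤K' e = subst (λ x → firstBlocked x π ≡ false) (ℕP.m∸n+n≡m K≤K') (mono (K' ∸ K))
    where
    mono : ∀ d → firstBlocked (d ℕ.+ K) π ≡ false
    mono zero    = e
    mono (suc d) rewrite mono d = refl

  firstBlocked-blocked : ∀ π K i → firstBlocked K π ≡ true → i < K → blocked (candidate i) π ≡ true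
  firstBlocked-blocked π (suc K) i e i<1+K with firstBlocked K π in e'
  ... | true with ℕP.m≤n⇒m<n∨m≡n i<1+K
  ...   | inj₁ (s≤s i<K) = firstBlocked-blocked π K i e' i<K
  ...   | inj₂ refl      = e

  Occurs : ℕ → List Part → Set
  Occurs v = Any (λ p → proj₁ p ≡ v)

  hasOver-occurs : ∀ v π → hasOver v π ≡ true → Occurs v π
  hasOver-occurs v ((w , o) ∷ π) h with w ℕ.≡ᵇ v | ℕP.≡ᵇ⇒≡ w v
  ... | true  | w≡v = here (w≡v _)
  ... | false | _   = there (hasOver-occurs v π h)

  countPlain-occurs : ∀ v π → 1 ≤ countPlain v π → Occurs v π
  countPlain-occurs v ((w , o) ∷ π) c≥1 with w ℕ.≡ᵇ v | ℕP.≡ᵇ⇒≡ w v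
  ... | true  | w≡v = here (w≡v _)
  ... | false | _   = there (countPlain-occurs v π c≥1)

  blocked-occurs : ∀ v π → blocked v π ≡ true → Occurs v π
  blocked-occurs v π b with hasOver v π in over
  ... | true  = hasOver-occurs v π over
  ... | false with countPlain v π ℕ.<? r ∸ 1
  ...   | yes c<t = contradiction (trans (sym (cong not (dec-true (countPlain v π ℕ.<? r ∸ 1) c<t))) b) λ ()
  ...   | no  c≮t = countPlain-occurs v π (ℕP.≤-trans (ℕP.∸-monoˡ-≤ 1 2≤r) (ℕP.≮⇒≥ c≮t))

  -- Pigeonhole: blocked candidates occur as distinct part sizes of π.
  firstBlocked-length : ∀ π → firstBlocked (suc (length π)) π ≡ false
  firstBlocked-length π with firstBlocked (suc (length π)) π in e
  ... | false = refl
  ... | true  = contradiction (pigeonhole (ℕP.n<1+n (length π)) position) no-collision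
    where
    occurs : ∀ (i : Fin (suc (length π))) → Occurs (candidate (toℕ i)) π
    occurs i = blocked-occurs (candidate (toℕ i)) π (firstBlocked-blocked π (suc (length π)) (toℕ i) e (toℕ<n i))
    position : Fin (suc (length π)) → Fin (length π)
    position i = Any.index (occurs i)
    no-collision : ¬ (∃₂ λ i j → i Fin.< j × position i ≡ position j)
    no-collision (i , j , i<j , same) =
      ℕP.<⇒≢ (candidate-mono i<j) (trans (sym (lookup-index (occurs i))) (trans (cong (λ k → proj₁ (lookup π k)) same) (lookup-index (occurs j))))

  blockedPrefix : List Part → ℕ → ℕ
  blockedPrefix π k = if firstBlocked (suc k) π then 1 else 0

  mesSearch≡candidate : ∀ π f j → firstBlocked j π ≡ true →
    mesSearch r A a π f j ≡ candidate (j ℕ.+ ℕΣ.Σ< f (λ i → blockedPrefix π (j ℕ.+ i)))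
  mesSearch≡candidate π zero    j _  = cong candidate (sym (ℕP.+-identityʳ j))
  mesSearch≡candidate π (suc f) j bj with free r π (candidate j) in free?
  ... | true  = cong candidate (sym (trans (cong (j ℕ.+_) (ℕΣ.Σ<-zero (suc f) _ later-unblocked)) (ℕP.+-identityʳ j)))
    where
    later-unblocked : ∀ i → i < suc f → blockedPrefix π (j ℕ.+ i) ≡ 0
    later-unblocked i _ rewrite firstBlocked-false-mono π (s≤s (ℕP.m≤m+n j i)) (trans (cong (_∧ blocked (candidate j) π) bj) (cong not free?)) = refl
  ... | false = begin
    mesSearch r A a π f (suc j)                                              ≡⟨ mesSearch≡candidate π f (suc j) b₁₊ⱼ ⟩
    candidate (suc j ℕ.+ ℕΣ.Σ< f (λ i → blockedPrefix π (suc j ℕ.+ i)))      ≡⟨ cong candidate (sym (ℕP.+-suc j _)) ⟩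
    candidate (j ℕ.+ suc (ℕΣ.Σ< f (λ i → blockedPrefix π (suc j ℕ.+ i))))    ≡⟨ cong (λ x → candidate (j ℕ.+ x)) (cong₂ ℕ._+_ (sym first) (ℕΣ.Σ<-cong f (λ i _ → cong (blockedPrefix π) (sym (ℕP.+-suc j i))))) ⟩
    candidate (j ℕ.+ ℕΣ.Σ< (suc f) (λ i → blockedPrefix π (j ℕ.+ i)))        ∎
    where
    open ≡-Reasoning
    b₁₊ⱼ : firstBlocked (suc j) π ≡ true
    b₁₊ⱼ = trans (cong (_∧ blocked (candidate j) π) bj) (cong not free?)
    first : blockedPrefix π (j ℕ.+ 0) ≡ 1
    first rewrite ℕP.+-identityʳ j | b₁₊ⱼ = refl

  length≤weight : ∀ π → All (λ p → 1 ≤ proj₁ p) π → length π ≤ weight π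
  length≤weight []      _            = z≤n
  length≤weight (p ∷ π) (1≤p ∷ rest) = ℕP.+-mono-≤ 1≤p (length≤weight π rest)

  mes≡candidate : ∀ n π → IsOverpartition n π → mes r A a π ≡ candidate (ℕΣ.Σ< n (blockedPrefix π))
  mes≡candidate n π (positive , _ , weight≡) =
    trans (mesSearch≡candidate π (length π) 0 refl)
          (cong candidate (ℕΣ.Σ<-extend (length π) n (blockedPrefix π) length≤n beyond-length))
    where
    length≤n : length π ≤ n
    length≤n = ℕP.≤-trans (length≤weight π positive) (ℕP.≤-reflexive weight≡)
    beyond-length : ∀ i → length π ≤ i → i < n → blockedPrefix π i ≡ 0
    beyond-length i L≤i _ rewrite firstBlocked-false-mono π (s≤s L≤i) (firstBlocked-length π) = refl

module RightHandSide (r A a : ℕ) (1≤a : 1 ≤ a) where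

  open PowerSeries
  open Levels using (overpartitionSeries)
  open import Data.Nat as ℕ using (suc; _∸_; _<_; s≤s)
  open import Data.List using (map; upTo)
  import Data.Nat.Properties as ℕP
  open import Data.Nat.Combinatorics using (_C_)
  open import Data.Integer using (0ℤ; 1ℤ; _+_; _*_)
  import Data.List.Properties as LP
  open import Relation.Binary.PropositionalEquality
  open ℤΣ using (Σ<; Σ<-extend)

  -- The k-th summand is O(q^k), since A binom(k,2) + k a ≥ k.
  term-vanishes : ∀ k j → j < k → term r A a k j ≡ 0ℤ
  term-vanishes k j j<k = trans (⊛-assoc (monomial 1ℤ e) (inv (qPoch 1ℤ a A k)) R j)
                                (monomial-⊛-< 1ℤ e (inv (qPoch 1ℤ a A k) ⊛ R) j (ℕP.<-≤-trans j<k k≤e))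
    where
    R = qPoch 1ℤ ((r ∸ 2) ℕ.* a) ((r ∸ 2) ℕ.* A) k
    e = A ℕ.* (k C 2) ℕ.+ k ℕ.* a
    k≤e : k ≤ e
    k≤e = ℕP.≤-trans (ℕP.m≤m*n k a {{ℕ.>-nonZero 1≤a}}) (ℕP.m≤n+m (k ℕ.* a) (A ℕ.* (k C 2)))

  termSum≈Σ< : ∀ n → termSum r A a ≈[ n ] (λ j → Σ< n (λ k → term r A a (suc k) j))
  termSum≈Σ< n j j≤n = begin
    sumℤ (map (λ k → term r A a k j) (map suc (upTo j)))   ≡⟨ cong sumℤ (trans (sym (LP.map-∘ (upTo j))) (LP.map-upTo _ j)) ⟩
    Σ< j (λ k → term r A a (suc k) j)                        ≡⟨ Σ<-extend j n _ j≤n (λ k j≤k _ → term-vanishes (suc k) j (s≤s j≤k)) ⟩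
    Σ< n (λ k → term r A a (suc k) j)                        ∎
    where open ≡-Reasoning

  rhs-coeff : ∀ n → rhs r A a n ≡ + a * overpartitionSeries n + + A * Σ< n (λ k → (overpartitionSeries ⊛ term r A a (suc k)) n)
  rhs-coeff n = begin
    rhs r A a n
      ≡⟨ ⊛-distribˡ-⊕ D (const (+ a)) (const (+ A) ⊛ termSum r A a) n ⟩
    (D ⊛ const (+ a)) n + (D ⊛ (const (+ A) ⊛ termSum r A a)) n
      ≡⟨ cong₂ _+_ (trans (⊛-comm D (const (+ a)) n) (const-⊛ (+ a) D n))
                   (trans (⊛-congʳ D (const-⊛ (+ A) (termSum r A a)) n) (⊛-scaleʳ (+ A) (termSum r A a) D n)) ⟩
    + a * D n + + A * (D ⊛ termSum r A a) n
      ≡⟨ cong (λ x → + a * D n + + A * x) (trans (⊛-cong≈ {f = D} ≈-refl (termSum≈Σ< n) n ℕP.≤-refl) (⊛-Σ<ʳ n D (λ k → term r A a (suc k)) n)) ⟩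
    + a * D n + + A * Σ< n (λ k → (D ⊛ term r A a (suc k)) n)
      ∎
    where
    open ≡-Reasoning
    D = overpartitionSeries

module Main (r A a : ℕ) (1≤a : 1 ≤ a) (1≤A : 1 ≤ A) (2≤r : 2 ≤ r) (n : ℕ) where

  open PowerSeries
  open Levels using (𝟙; overpartitionSeries; prodTo-freeLevel≈overpartitionSeries)
  open Overpartitions
  open Candidates A a 1≤a 1≤A
  open CandidateProducts r A a 1≤a 1≤A 2≤r using (prodTo-constrainedLevel)
  open Counting r A a 1≤a 1≤A 2≤r
  open RightHandSide r A a 1≤a using (rhs-coeff)
  open IntegerSums using (sum-map-*ˡ; pos-sum; pos-Σ<)
  open import Data.Nat as ℕ using (suc; _<_)
  import Data.Nat.Properties as ℕP
  open import Data.Integer using (ℤ; 1ℤ; _+_; _*_)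
  import Data.Integer.Properties as ℤP
  open import Data.Bool using (true; false)
  open import Data.List using (map)
  open import Data.Product using (proj₁)
  import Data.List.Properties as LP
  import Data.List.Relation.Unary.All as All
  open import Data.List.Membership.Propositional using (_∈_)
  open import Relation.Binary.PropositionalEquality
  open ℤΣ using (sum; Σ<; Σ<-cong; sum-map-cong; sum-map-∙; sum-map-Σ<)
  open import Data.Nat.ListAction.Properties using (sum-↭)
  open import Data.List.Relation.Binary.Permutation.Propositional.Properties using (map⁺)

  -- Parts of an overpartition of n are ≤ n, and the first n candidates are ≤ M₀.
  M₀ : ℕ
  M₀ = n ℕ.+ candidate n

  n≤M₀ : n ≤ M₀
  n≤M₀ = ℕP.m≤m+n n (candidate n)

  candidates≤M₀ : ∀ k → k ≤ n → ∀ i → i < k → candidate i ≤ M₀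
  candidates≤M₀ k k≤n i i<k = ℕP.≤-trans (ℕP.<⇒≤ (candidate-mono (ℕP.<-≤-trans i<k k≤n))) (ℕP.m≤n+m (candidate n) n)

  E : List (List Part)
  E = overpartitions n M₀ n

  W : ℕ → List Part → ℤ
  W k π = 𝟙 (constraintsHold k M₀ π)

  pos-blockedPrefix : ∀ π k → k < n → + blockedPrefix π k ≡ W (suc k) π
  pos-blockedPrefix π k k<n rewrite constraintsHold≡firstBlocked (suc k) M₀ π (candidates≤M₀ (suc k) k<n) with firstBlocked (suc k) π
  ... | true  = refl
  ... | false = refl

  mes-decomposition : ∀ π → π ∈ E → + mes r A a π ≡ + a * W 0 π + + A * Σ< n (λ k → W (suc k) π)
  mes-decomposition π π∈ = begin
    + mes r A a π                                    ≡⟨ cong +_ (mes≡candidate n π (proj₁ (overpartitions-sound n M₀ n π π∈))) ⟩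
    + (a ℕ.+ S ℕ.* A)                                ≡⟨ ℤP.pos-+ a (S ℕ.* A) ⟩
    + a + + (S ℕ.* A)                                ≡⟨ cong₂ _+_ (sym (ℤP.*-identityʳ (+ a))) (trans (ℤP.pos-* S A) (ℤP.*-comm (+ S) (+ A))) ⟩
    + a * 1ℤ + + A * + S                             ≡⟨ cong₂ (λ x y → + a * x + + A * y) (cong 𝟙 (sym (constraintsHold≡firstBlocked 0 M₀ π (λ _ ()))))
                                                              (trans (pos-Σ< n (blockedPrefix π)) (Σ<-cong n (λ k k<n → pos-blockedPrefix π k k<n))) ⟩
    + a * W 0 π + + A * Σ< n (λ k → W (suc k) π)     ∎
    where
    open ≡-Reasoning
    S = ℕΣ.Σ< n (blockedPrefix π)

  sumMes-E : + sumMes r A a E ≡ + a * count n 0 M₀ n + + A * Σ< n (λ k → count n (suc k) M₀ n)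
  sumMes-E = begin
    + sumMes r A a E
      ≡⟨ trans (pos-sum (map (mes r A a) E)) (cong sum (sym (LP.map-∘ E))) ⟩
    sum (map (λ π → + mes r A a π) E)
      ≡⟨ sum-map-cong E (All.tabulate (λ {π} → mes-decomposition π)) ⟩
    sum (map (λ π → + a * W 0 π + + A * Σ< n (λ k → W (suc k) π)) E)
      ≡⟨ sum-map-∙ (λ π → + a * W 0 π) (λ π → + A * Σ< n (λ k → W (suc k) π)) E ⟩
    sum (map (λ π → + a * W 0 π) E) + sum (map (λ π → + A * Σ< n (λ k → W (suc k) π)) E)
      ≡⟨ cong₂ _+_ (sum-map-*ˡ (+ a) (W 0) E)
                   (trans (sum-map-*ˡ (+ A) (λ π → Σ< n (λ k → W (suc k) π)) E) (cong (+ A *_) (sum-map-Σ< n (λ π k → W (suc k) π) E))) ⟩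
    + a * count n 0 M₀ n + + A * Σ< n (λ k → count n (suc k) M₀ n)
      ∎
    where open ≡-Reasoning

  sumMes≡rhs : ∀ Ls → Enumerates n Ls → + sumMes r A a Ls ≡ rhs r A a n
  sumMes≡rhs Ls enumerates = begin
    + sumMes r A a Ls
      ≡⟨ cong +_ (sum-↭ (map⁺ (mes r A a) (enumerations-↭ enumerates (overpartitions-enumerate n M₀ n≤M₀)))) ⟩
    + sumMes r A a E
      ≡⟨ sumMes-E ⟩
    + a * count n 0 M₀ n + + A * Σ< n (λ k → count n (suc k) M₀ n)
      ≡⟨ cong₂ (λ x y → + a * x + + A * y) (trans (count≗prodTo n 0 M₀ n) (prodTo-freeLevel≈overpartitionSeries n M₀ n≤M₀ n ℕP.≤-refl))
                                            (Σ<-cong n count-suc≡) ⟩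
    + a * overpartitionSeries n + + A * Σ< n (λ k → (overpartitionSeries ⊛ term r A a (suc k)) n)
      ≡⟨ rhs-coeff n ⟨
    rhs r A a n
      ∎
    where
    open ≡-Reasoning
    count-suc≡ : ∀ k → k < n → count n (suc k) M₀ n ≡ (overpartitionSeries ⊛ term r A a (suc k)) n
    count-suc≡ k k<n = trans (count≗prodTo n (suc k) M₀ n)
                             (prodTo-constrainedLevel n M₀ (suc k) n≤M₀ (candidates≤M₀ (suc k) k<n) n ℕP.≤-refl)

theorem2p9 : (r A a : ℕ) → 1 ≤ a → a ≤ A → 2 ≤ r → (n : ℕ) →
    (Σ[ Ls ∈ List (List Part) ] Enumerates n Ls)
    × (∀ Ls → Enumerates n Ls → + sumMes r A a Ls ≡ rhs r A a n)
theorem2p9 r A a 1≤a a≤A 2≤r n =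
  (Overpartitions.overpartitions n n n , Overpartitions.overpartitions-enumerate n n Data.Nat.Properties.≤-refl) ,
  Main.sumMes≡rhs r A a 1≤a (Data.Nat.Properties.≤-trans 1≤a a≤A) 2≤r n
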